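{- Let $t\ge2$, $a\in\{0,1\}$, and let $\pi$ be a partition with $t$-core $\pi_{t\text{ -core}}$, $t$-quotient $(\hat\pi_0,\dots,\hat\pi_{t-1})$, and let $(n_0,\dots,n_{t-1})$ be the $n$-vector of $\pi_{t\text{ -core}}$. If $t\equiv2a\pmod4$, then \[ \mathrm{srank}(\pi)\equiv\mathrm{srank}(\pi_{t\text{ -core}})+2a\sum_{i=0}^{t-1}|\hat\pi_i|\pmod 4; \] and if $t\equiv1+2a\pmod4$, then \[ \mathrm{srank}(\pi)\equiv\mathrm{srank}(\pi_{t\text{ -core}})+2\sum_{i=0}^{t-1}(n_i+i+a)|\hat\pi_i|+\sum_{i=0}^{t-1}\mathrm{srank}(\hat\pi_i)\pmod 4. \]
   Context: For a partition $\pi$ with conjugate $\pi'$, $\mathcal{O}(\pi)$ is the number of odd parts and $\mathrm{srank}(\pi)=\mathcal{O}(\pi)-\mathcal{O}(\pi')$. Littlewood decomposition: for $\pi=(\lambda_1\ge\lambda_2\ge\cdots)$ with $\lambda_k=0$ beyond its number of parts, let $S(\pi)=\{\lambda_k-k:k\ge1\}$. For $i\in\{0,\dots,t-1\}$ and $r\in\mathbb Z$ set $W_i(r)=E$ if $t(r-1)+i\in S(\pi)$ and $W_i(r)=N$ otherwise. The $i$-th quotient component $\hat\pi_i$ is the partition whose parts are the nonzero numbers $\#\{r'>r:W_i(r')=E\}$, one for each $r$ with $W_i(r)=N$. Put $n_i=\#\{r\ge1:W_i(r)=E\}-\#\{r\le0:W_i(r)=N\}$; then $\sum_i n_i=0$,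 and the $t$-core $\pi_{t\text{ -core}}$ of $\pi$ is the partition whose words satisfy $W_i(r)=E$ iff $r\le n_i$ (it is the partition obtained by removing rim hooks of length $t$ until none remain). The vector $(n_0,\dots,n_{t-1})$ is the $n$-vector of $\pi_{t\text{ -core}}$; equivalently $n_i=r_i-r_{i+1}$ (indices mod $t$) where $r_i$ is the number of cells $(a,b)$ (row $a$, column $b$) of the diagram of $\pi_{t\text{ -core}}$ with $b-a\equiv i\pmod t$. One has $|\pi|=|\pi_{t\text{ -core}}|+t\sum_i|\hat\pi_i|$. -}

module Defs where

open import Data.Bool using (Bool; true; false)
open import Data.Nat as ℕ using (ℕ; zero; suc; _⊔_; _%_; _≤?_)
import Data.Nat.Properties as ℕP
open import Data.Integer as ℤ using (ℤ; +_; _-_; _*_; _≤_; ∣_∣)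
import Data.Integer.Properties as ℤP
open import Data.Integer.Divisibility using (_∣_)
open import Data.List using (List; []; _∷_; length; filter; map; upTo; foldr)
open import Data.Nat.ListAction using (sum)
open import Data.Bool.ListAction using (any)
open import Data.List.Relation.Unary.All using (All)
open import Data.List.Relation.Unary.Linked using (Linked)
open import Relation.Nullary.Decidable using (⌊_⌋; ¬?)
open import Relation.Binary.PropositionalEquality using (_≡_)

IsPartition : List ℕ → Set
IsPartition π = Linked ℕ._≥_ π × All (λ p → 0 ℕ.< p) π
  where open import Data.Product using (_×_)

size : List ℕ → ℕ
size = sum

-- λ_{k+1} (0-indexed), with λ_k = 0 beyond the number of parts
part : List ℕ → ℕ → ℕ
part []       _       = 0
part (p ∷ _)  zero    = p
part (_ ∷ ps) (suc k) = part ps k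

maxPart : List ℕ → ℕ
maxPart = foldr _⊔_ 0

conj : List ℕ → List ℕ
conj π = map (λ j → length (filter (λ p → suc j ≤? p) π)) (upTo (maxPart π))

oddParts : List ℕ → ℕ
oddParts π = length (filter (λ p → p % 2 ℕ.≟ 1) π)

srank : List ℕ → ℤ
srank π = + oddParts π - + oddParts (conj π)

-- m ∈ S(π) = {λ_k − k : k ≥ 1}.  For k > ℓ(π) one has λ_k − k = −k, so
-- searching k ≤ ℓ(π) + |m| + 1 is an exact (bounded) search.
inS : List ℕ → ℤ → Bool
inS π m = any (λ k → ⌊ (+ part π k - + suc k) ℤ.≟ m ⌋) (upTo (suc (length π ℕ.+ ∣ m ∣)))

-- W_i(r) = E  (as a Bool: true = E, false = N), for modulus t
W : ℕ → List ℕ → ℕ → ℤ → Bool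
W t π i r = inS π (+ t ℤ.* (r - + 1) ℤ.+ + i)

-- A bound B(π) such that, for t ≥ 2, W_i(r) = N for all r ≥ B and
-- W_i(r) = E for all r ≤ −B; all the (a priori infinite) counts below
-- only receive contributions from r ∈ [−B, B].
bound : List ℕ → ℕ
bound π = suc (sum π ℕ.+ length π)

range : ℤ → ℕ → List ℤ
range lo n = map (λ j → lo ℤ.+ + j) (upTo n)

window : List ℕ → List ℤ
window π = range (ℤ.- + bound π) (suc (2 ℕ.* bound π))

posWindow negWindow : List ℕ → List ℤ
posWindow π = range (+ 1) (bound π)
negWindow π = range (ℤ.- + bound π) (suc (bound π))

countTrue : List Bool → ℕ
countTrue bs = length (filter (λ b → b Data.Bool.≟ true) bs)
  where import Data.Bool

nvec : ℕ → List ℕ → ℕ → ℤ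
nvec t π i = + countTrue (map (W t π i) (posWindow π))
           - + countTrue (map (λ r → Data.Bool.not (W t π i r)) (negWindow π))
  where import Data.Bool

eAbove : ℕ → List ℕ → ℕ → ℤ → ℕ
eAbove t π i r =
  countTrue (map (W t π i) (filter (λ r' → r ℤ.<? r') (window π)))

-- i-th quotient component: the nonzero numbers #{r' > r : W_i(r') = E},
-- one for each r with W_i(r) = N (listed for increasing r, hence weakly decreasing)
quot : ℕ → List ℕ → ℕ → List ℕ
quot t π i =
  filter (λ c → ¬? (c ℕ.≟ 0))
    (map (eAbove t π i)
      (filter (λ r → W t π i r Data.Bool.≟ false) (window π)))
  where import Data.Bool

-- κ is the t-core of π: the partition whose words satisfy
-- W_i(r) = E  iff  r ≤ n_i  (for all i ∈ {0,…,t−1}, r ∈ ℤ)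
IsTCoreOf : ℕ → List ℕ → List ℕ → Set
IsTCoreOf t κ π =
  IsPartition κ ×
  ((i : ℕ) → i ℕ.< t → (r : ℤ) → (W t κ i r ≡ true → r ≤ nvec t π i) × (r ≤ nvec t π i → W t κ i r ≡ true))
  where open import Data.Product using (_×_)

Σ< : ℕ → (ℕ → ℤ) → ℤ
Σ< t f = foldr ℤ._+_ (+ 0) (map f (upTo t))

_≡₄_ : ℤ → ℤ → Set
a ≡₄ b = + 4 ∣ (a - b)

{-# OPTIONS --safe #-}
module Submission where

-- Encode a partition μ by its β-set S(μ) = {λ_k − k} and compare it with S([]) = {m < 0}: summing
-- h(m) over the difference gives 0, |μ| and θ μ (twice the content sum of μ) for h(m) = 1, m, m² + m,
-- and srank μ ≡ θ μ (mod 4), since adding a largest part p changes 𝒪(μ′) to p − 𝒪(μ′).  Writing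
-- m = t(r − 1) + i splits S(π) into the words W_i of π and S(κ) into the packed words E^{E_i} N N …
-- of its t-core; in residue class i the first and second moments of their difference are |π̂_i| and
-- (2 n_i − 1)|π̂_i| − θ π̂_i.  Hence θ π − θ κ = ∑_i t²((2 n_i − 1)|π̂_i| − θ π̂_i) + t(2i + 1)|π̂_i|,
-- and reducing t² and t(2i + 1) modulo 4 for t = 2a + 4c and t = 1 + 2a + 4c gives both congruences.

open import Defs
open import Data.Nat using (ℕ; _≤_; _%_)
open import Data.Integer using (ℤ; +_; _+_; _*_)
open import Data.List using (List)
open import Data.Product using (_×_)
open import Relation.Binary.PropositionalEquality using (_≡_)

open import Data.Bool using (Bool; true; false; not; _∨_)
import Data.Bool
open import Data.Bool.Properties using (T-≡; ⇔→≡; ∨-zeroʳ)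
open import Data.List.Relation.Unary.Any.Properties using (any⁺; any⁻; applyUpTo⁺; applyUpTo⁻)
open import Data.Nat as ℕ using (zero; suc)
import Data.Nat.Properties as ℕP
open import Data.Integer as ℤ using (-[1+_]; _-_; -_; ∣_∣)
import Data.Integer.Properties as ℤP
open import Data.Integer.Divisibility.Signed using (divides; ∣m∣n⇒∣m+n; ∣m∣n⇒∣m-n; ∣⇒∣ᵤ)
  renaming (_∣_ to _∣ˢ_)
open import Data.Nat.DivMod using (m≡m%n+[m/n]*n)
open import Data.Integer.DivMod using (_%ℕ_; _/ℕ_; a≡a%ℕn+[a/ℕn]*n; n%ℕd<d)
open import Data.Integer.Tactic.RingSolver using (solve-∀)
open import Data.List using ([]; _∷_; upTo; length; filter; map; applyUpTo; foldr; replicate)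
import Data.List.Properties as LP
open import Data.List.Relation.Unary.All as All using (All; []; _∷_)
import Data.List.Relation.Unary.All.Properties as AllP
open import Data.List.Relation.Unary.AllPairs using (AllPairs; []; _∷_)
import Data.List.Relation.Unary.AllPairs.Properties as AllPairsP
open import Data.List.Relation.Unary.Linked.Properties using (Linked⇒AllPairs)
open import Data.Product using (∃-syntax; _,_; proj₁; proj₂)
open import Function using (_∘_; id; Equivalence; mk⇔)
open import Relation.Unary using (Decidable)
open import Relation.Binary.PropositionalEquality using (_≢_; refl; sym; trans; cong; cong₂; subst; subst₂; module ≡-Reasoning)
open import Relation.Nullary using (does; yes; no; contradiction)
open import Relation.Nullary.Decidable using (¬?; ⌊_⌋; toWitness; fromWitness; dec-true; dec-false)

⟦_⟧ : Bool → ℤ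
⟦ true  ⟧ = + 1
⟦ false ⟧ = + 0

-- Finite sums

∑ : ℕ → (ℕ → ℤ) → ℤ
∑ zero    f = + 0
∑ (suc n) f = f 0 + ∑ n (f ∘ suc)

∑-cong : ∀ n {f g : ℕ → ℤ} → (∀ j → j ℕ.< n → f j ≡ g j) → ∑ n f ≡ ∑ n g
∑-cong zero    eq = refl
∑-cong (suc n) eq = cong₂ _+_ (eq 0 (ℕ.s≤s ℕ.z≤n)) (∑-cong n (λ j j<n → eq (suc j) (ℕ.s≤s j<n)))

∑-zero : ∀ n {f : ℕ → ℤ} → (∀ j → j ℕ.< n → f j ≡ + 0) → ∑ n f ≡ + 0
∑-zero zero    eq = refl
∑-zero (suc n) eq = cong₂ _+_ (eq 0 (ℕ.s≤s ℕ.z≤n)) (∑-zero n (λ j j<n → eq (suc j) (ℕ.s≤s j<n)))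

∑-const : ∀ n → ∑ n (λ _ → + 1) ≡ + n
∑-const zero    = refl
∑-const (suc n) = cong (_+_ (+ 1)) (∑-const n)

∑-distrib-+ : ∀ n (f g : ℕ → ℤ) → ∑ n (λ j → f j + g j) ≡ ∑ n f + ∑ n g
∑-distrib-+ zero    f g = refl
∑-distrib-+ (suc n) f g = begin
  f 0 + g 0 + ∑ n (λ j → f (suc j) + g (suc j))  ≡⟨ cong (_+_ (f 0 + g 0)) (∑-distrib-+ n (f ∘ suc) (g ∘ suc)) ⟩
  f 0 + g 0 + (∑ n (f ∘ suc) + ∑ n (g ∘ suc))    ≡⟨ swap (f 0) (g 0) _ _ ⟩
  f 0 + ∑ n (f ∘ suc) + (g 0 + ∑ n (g ∘ suc))    ∎
  where
  open ≡-Reasoning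
  swap : ∀ a b c d → a + b + (c + d) ≡ a + c + (b + d)
  swap = solve-∀

*-distribˡ-∑ : ∀ c n (f : ℕ → ℤ) → c * ∑ n f ≡ ∑ n (λ j → c * f j)
*-distribˡ-∑ c zero    f = ℤP.*-zeroʳ c
*-distribˡ-∑ c (suc n) f = trans (ℤP.*-distribˡ-+ c (f 0) _) (cong (_+_ (c * f 0)) (*-distribˡ-∑ c n (f ∘ suc)))

∑-distrib-minus : ∀ n (f g : ℕ → ℤ) → ∑ n (λ j → f j - g j) ≡ ∑ n f - ∑ n g
∑-distrib-minus zero    f g = refl
∑-distrib-minus (suc n) f g = trans (cong (_+_ (f 0 - g 0)) (∑-distrib-minus n (f ∘ suc) (g ∘ suc)))
                                (swap (f 0) (g 0) (∑ n (f ∘ suc)) (∑ n (g ∘ suc)))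
  where
  swap : ∀ a b c d → a - b + (c - d) ≡ a + c - (b + d)
  swap = solve-∀

∑-split : ∀ m n (f : ℕ → ℤ) → ∑ (m ℕ.+ n) f ≡ ∑ m f + ∑ n (λ j → f (m ℕ.+ j))
∑-split zero    n f = sym (ℤP.+-identityˡ _)
∑-split (suc m) n f = trans (cong (_+_ (f 0)) (∑-split m n (f ∘ suc))) (sym (ℤP.+-assoc (f 0) _ _))

∑-extend : ∀ {m n} (f : ℕ → ℤ) → m ℕ.≤ n → (∀ j → m ℕ.≤ j → f j ≡ + 0) → ∑ m f ≡ ∑ n f
∑-extend {m} {n} f m≤n beyond = begin
  ∑ m f                                        ≡⟨ sym (ℤP.+-identityʳ _) ⟩
  ∑ m f + + 0                                  ≡⟨ cong (_+_ (∑ m f)) (sym (∑-zero (n ℕ.∸ m) (λ j _ → beyond (m ℕ.+ j) (ℕP.m≤m+n m j)))) ⟩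
  ∑ m f + ∑ (n ℕ.∸ m) (λ j → f (m ℕ.+ j))      ≡⟨ sym (∑-split m (n ℕ.∸ m) f) ⟩
  ∑ (m ℕ.+ (n ℕ.∸ m)) f                        ≡⟨ cong (λ k → ∑ k f) (ℕP.m+[n∸m]≡n m≤n) ⟩
  ∑ n f                                        ∎
  where open ≡-Reasoning

∑-residues : ∀ t N (F : ℕ → ℤ) → ∑ (t ℕ.* N) F ≡ ∑ t (λ i → ∑ N (λ y → F (t ℕ.* y ℕ.+ i)))
∑-residues t zero    F rewrite ℕP.*-zeroʳ t = sym (∑-zero t (λ _ _ → refl))
∑-residues t (suc N) F = begin
  ∑ (t ℕ.* suc N) F
    ≡⟨ cong (λ k → ∑ k F) (ℕP.*-suc t N) ⟩
  ∑ (t ℕ.+ t ℕ.* N) F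
    ≡⟨ ∑-split t (t ℕ.* N) F ⟩
  ∑ t F + ∑ (t ℕ.* N) (λ j → F (t ℕ.+ j))
    ≡⟨ cong (_+_ (∑ t F)) (∑-residues t N (λ j → F (t ℕ.+ j))) ⟩
  ∑ t F + ∑ t (λ i → ∑ N (λ y → F (t ℕ.+ (t ℕ.* y ℕ.+ i))))
    ≡⟨ sym (∑-distrib-+ t F _) ⟩
  ∑ t (λ i → F i + ∑ N (λ y → F (t ℕ.+ (t ℕ.* y ℕ.+ i))))
    ≡⟨ ∑-cong t (λ i _ → cong₂ _+_ (cong F (cong (ℕ._+ i) (sym (ℕP.*-zeroʳ t))))
                                   (∑-cong N (λ y _ → cong F (next-row y i)))) ⟩
  ∑ t (λ i → ∑ (suc N) (λ y → F (t ℕ.* y ℕ.+ i)))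
    ∎
  where
  open ≡-Reasoning
  next-row : ∀ y i → t ℕ.+ (t ℕ.* y ℕ.+ i) ≡ t ℕ.* suc y ℕ.+ i
  next-row y i = trans (sym (ℕP.+-assoc t (t ℕ.* y) i)) (cong (ℕ._+ i) (sym (ℕP.*-suc t y)))

∑-select : ∀ n {k} (b : ℕ → Bool) (g : ℕ → ℤ) → k ℕ.< n → b k ≡ true →
           (∀ j → j ≢ k → b j ≡ false) → ∑ n (λ j → ⟦ b j ⟧ * g j) ≡ g k
∑-select (suc n) {zero} b g _ bk≡true others rewrite bk≡true =
  trans (cong₂ _+_ (ℤP.*-identityˡ (g 0))
                   (∑-zero n (λ j _ → cong (λ c → ⟦ c ⟧ * g (suc j)) (others (suc j) (λ ())))))
        (ℤP.+-identityʳ (g 0))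
∑-select (suc n) {suc k} b g (ℕ.s≤s k<n) bk≡true others rewrite others 0 (λ ()) =
  trans (ℤP.+-identityˡ _) (∑-select n (b ∘ suc) (g ∘ suc) k<n bk≡true (λ j j≢k → others (suc j) (j≢k ∘ ℕP.suc-injective)))

foldr-+-applyUpTo : ∀ n (f : ℕ → ℤ) → foldr _+_ (+ 0) (applyUpTo f n) ≡ ∑ n f
foldr-+-applyUpTo zero    f = refl
foldr-+-applyUpTo (suc n) f = cong (_+_ (f 0)) (foldr-+-applyUpTo n (f ∘ suc))

Σ<≡∑ : ∀ n (f : ℕ → ℤ) → Σ< n f ≡ ∑ n f
Σ<≡∑ n f = trans (cong (foldr _+_ (+ 0)) (LP.map-upTo f n)) (foldr-+-applyUpTo n f)

∑-∣ : ∀ {k} n (f : ℕ → ℤ) → (∀ j → j ℕ.< n → k ∣ˢ f j) → k ∣ˢ ∑ n f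
∑-∣ {k} zero    f _   = divides (+ 0) (sym (ℤP.*-zeroˡ k))
∑-∣     (suc n) f k∣f = ∣m∣n⇒∣m+n (k∣f 0 (ℕ.s≤s ℕ.z≤n)) (∑-∣ n (f ∘ suc) (λ j j<n → k∣f (suc j) (ℕ.s≤s j<n)))

-- Conjugates and the signed rank

odd : ℕ → Bool
odd p = does (p % 2 ℕ.≟ 1)

odd-suc : ∀ c → ⟦ odd (suc c) ⟧ + ⟦ odd c ⟧ ≡ + 1
odd-suc 0             = refl
odd-suc 1             = refl
odd-suc (suc (suc c)) = odd-suc c

odd≡square-mod4 : ∀ p → + 4 ∣ˢ ⟦ odd p ⟧ - + p * + p
odd≡square-mod4 0             = divides (+ 0) refl
odd≡square-mod4 1             = divides (+ 0) refl
odd≡square-mod4 (suc (suc p)) =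
  subst (+ 4 ∣ˢ_) (sym (shift ⟦ odd p ⟧ (+ p)))
        (∣m∣n⇒∣m+n (odd≡square-mod4 p) (divides (- (+ p + + 1)) refl))
  where
  shift : ∀ o p → o - (+ 2 + p) * (+ 2 + p) ≡ o - p * p + - (p + + 1) * + 4
  shift = solve-∀

length-filter-∷ : ∀ {A : Set} {P : A → Set} (P? : Decidable P) x xs →
                  + length (filter P? (x ∷ xs)) ≡ ⟦ does (P? x) ⟧ + + length (filter P? xs)
length-filter-∷ P? x xs with does (P? x)
... | true  = refl
... | false = refl

oddParts-∷ : ∀ p ρ → + oddParts (p ∷ ρ) ≡ ⟦ odd p ⟧ + + oddParts ρ
oddParts-∷ = length-filter-∷ (λ p → p % 2 ℕ.≟ 1)

oddParts-applyUpTo : ∀ n (f : ℕ → ℕ) → + oddParts (applyUpTo f n) ≡ ∑ n (λ j → ⟦ odd (f j) ⟧)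
oddParts-applyUpTo zero    f = refl
oddParts-applyUpTo (suc n) f =
  trans (oddParts-∷ (f 0) _) (cong (_+_ ⟦ odd (f 0) ⟧) (oddParts-applyUpTo n (f ∘ suc)))

maxPart-lub : ∀ {p} ρ → All (ℕ._≤ p) ρ → maxPart ρ ℕ.≤ p
maxPart-lub ρ ρ≤p = LP.foldr-preservesᵇ ℕP.⊔-lub ℕ.z≤n ρ≤p

parts≤maxPart : ∀ ρ → All (ℕ._≤ maxPart ρ) ρ
parts≤maxPart ρ = LP.foldr-forcesᵇ (λ m n m⊔n≤o → ℕP.m⊔n≤o⇒m≤o m n m⊔n≤o , ℕP.m⊔n≤o⇒n≤o m n m⊔n≤o) 0 ρ ℕP.≤-refl

IsPartition⇒sorted : ∀ {μ} → IsPartition μ → AllPairs ℕ._≥_ μ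
IsPartition⇒sorted = Linked⇒AllPairs (λ p≥q q≥r → ℕP.≤-trans q≥r p≥q) ∘ proj₁

maxPart≤size : ∀ μ → maxPart μ ℕ.≤ size μ
maxPart≤size []      = ℕ.z≤n
maxPart≤size (p ∷ μ) = ℕP.⊔-lub (ℕP.m≤m+n p (size μ)) (ℕP.≤-trans (maxPart≤size μ) (ℕP.m≤n+m (size μ) p))

column : List ℕ → ℕ → ℕ
column μ j = length (filter (λ p → suc j ℕ.≤? p) μ)

column-∷ : ∀ {p j} ρ → j ℕ.< p → column (p ∷ ρ) j ≡ suc (column ρ j)
column-∷ {j = j} ρ j<p = cong length (LP.filter-accept (λ p → suc j ℕ.≤? p) j<p)

column-beyond : ∀ ρ {j} → maxPart ρ ℕ.≤ j → column ρ j ≡ 0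
column-beyond ρ max≤j = cong length (LP.filter-none (λ p → _ ℕ.≤? p)
  (All.map (λ p≤max j<p → ℕP.<-irrefl refl (ℕP.≤-trans j<p (ℕP.≤-trans p≤max max≤j))) (parts≤maxPart ρ)))

conjOdd : List ℕ → ℤ
conjOdd μ = + oddParts (conj μ)

conjOdd≡∑ : ∀ μ {n} → maxPart μ ℕ.≤ n → conjOdd μ ≡ ∑ n (λ j → ⟦ odd (column μ j) ⟧)
conjOdd≡∑ μ {n} max≤n = begin
  + oddParts (conj μ)                                       ≡⟨ cong (+_ ∘ oddParts) (LP.map-upTo (column μ) (maxPart μ)) ⟩
  + oddParts (applyUpTo (column μ) (maxPart μ))             ≡⟨ oddParts-applyUpTo (maxPart μ) (column μ) ⟩
  ∑ (maxPart μ) (λ j → ⟦ odd (column μ j) ⟧)                ≡⟨ ∑-extend _ max≤n (λ j max≤j → cong (⟦_⟧ ∘ odd) (column-beyond μ max≤j)) ⟩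
  ∑ n (λ j → ⟦ odd (column μ j) ⟧)                          ∎
  where open ≡-Reasoning

-- Adding a largest part p lengthens each of the first p columns by one, flipping its parity.
conjOdd-∷ : ∀ p ρ → All (ℕ._≤ p) ρ → conjOdd (p ∷ ρ) ≡ + p - conjOdd ρ
conjOdd-∷ p ρ ρ≤p = move (conjOdd (p ∷ ρ)) (conjOdd ρ) (+ p) (begin
  conjOdd (p ∷ ρ) + conjOdd ρ
    ≡⟨ cong₂ _+_ (conjOdd≡∑ (p ∷ ρ) (ℕP.⊔-lub ℕP.≤-refl max≤p)) (conjOdd≡∑ ρ max≤p) ⟩
  ∑ p (λ j → ⟦ odd (column (p ∷ ρ) j) ⟧) + ∑ p (λ j → ⟦ odd (column ρ j) ⟧)
    ≡⟨ sym (∑-distrib-+ p _ _) ⟩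
  ∑ p (λ j → ⟦ odd (column (p ∷ ρ) j) ⟧ + ⟦ odd (column ρ j) ⟧)
    ≡⟨ ∑-cong p (λ j j<p → trans (cong (λ c → ⟦ odd c ⟧ + _) (column-∷ ρ j<p)) (odd-suc (column ρ j))) ⟩
  ∑ p (λ _ → + 1)
    ≡⟨ ∑-const p ⟩
  + p ∎)
  where
  open ≡-Reasoning
  max≤p = maxPart-lub ρ ρ≤p
  move : ∀ x y z → x + y ≡ z → x ≡ z - y
  move x y z refl = x≡x+y-y x y
    where
    x≡x+y-y : ∀ x y → x ≡ x + y - y
    x≡x+y-y = solve-∀

conjOdd-parity : ∀ μ → AllPairs ℕ._≥_ μ → + 2 ∣ˢ conjOdd μ + + size μ
conjOdd-parity []      []               = divides (+ 0) refl
conjOdd-parity (p ∷ ρ) (ρ≤p ∷ sorted) =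
  subst (+ 2 ∣ˢ_) (sym eq) (∣m∣n⇒∣m-n (divides (+ p + + size ρ) refl) (conjOdd-parity ρ sorted))
  where
  regroup : ∀ p C s → p - C + (p + s) ≡ (p + s) * + 2 - (C + s)
  regroup = solve-∀
  eq : conjOdd (p ∷ ρ) + (+ p + + size ρ) ≡ (+ p + + size ρ) * + 2 - (conjOdd ρ + + size ρ)
  eq = trans (cong (_+ (+ p + + size ρ)) (conjOdd-∷ p ρ ρ≤p)) (regroup (+ p) (conjOdd ρ) (+ size ρ))

-- θ μ is twice the sum of the contents b − a of the cells (a, b) of μ.
θ : List ℕ → ℤ
θ []      = + 0
θ (p ∷ ρ) = + p * (+ p - + 1) + θ ρ - + 2 * + size ρ

θ-even : ∀ μ → + 2 ∣ˢ θ μ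
θ-even []      = divides (+ 0) refl
θ-even (p ∷ ρ) = ∣m∣n⇒∣m-n (∣m∣n⇒∣m+n (consecutive-even p) (θ-even ρ)) (divides (+ size ρ) (ℤP.*-comm (+ 2) (+ size ρ)))
  where
  consecutive-even : ∀ p → + 2 ∣ˢ + p * (+ p - + 1)
  consecutive-even zero    = divides (+ 0) refl
  consecutive-even (suc p) = subst (+ 2 ∣ˢ_) (sym (step (+ p))) (∣m∣n⇒∣m+n (consecutive-even p) (divides (+ p) refl))
    where
    step : ∀ p → (+ 1 + p) * (+ 1 + p - + 1) ≡ p * (p - + 1) + p * + 2
    step = solve-∀

srank≡θ-mod4 : ∀ μ → AllPairs ℕ._≥_ μ → + 4 ∣ˢ srank μ - θ μ
srank≡θ-mod4 []      []               = divides (+ 0) refl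
srank≡θ-mod4 (p ∷ ρ) (ρ≤p ∷ sorted) = subst (+ 4 ∣ˢ_) (sym eq)
  (∣m∣n⇒∣m+n (∣m∣n⇒∣m+n (srank≡θ-mod4 ρ sorted) (odd≡square-mod4 p)) (twice (conjOdd-parity ρ sorted)))
  where
  twice : ∀ {x} → + 2 ∣ˢ x → + 4 ∣ˢ + 2 * x
  twice {x} (divides q refl) = divides q (2[q2]≡q4 q)
    where
    2[q2]≡q4 : ∀ q → + 2 * (q * + 2) ≡ q * + 4
    2[q2]≡q4 = solve-∀
  regroup : ∀ o O C p θρ s →
            o + O - (p - C) - (p * (p - + 1) + θρ - + 2 * s) ≡ O - C - θρ + (o - p * p) + + 2 * (C + s)
  regroup = solve-∀
  eq : srank (p ∷ ρ) - θ (p ∷ ρ) ≡ srank ρ - θ ρ + (⟦ odd p ⟧ - + p * + p) + + 2 * (conjOdd ρ + + size ρ)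
  eq = trans (cong (_- θ (p ∷ ρ)) (cong₂ _-_ (oddParts-∷ p ρ) (conjOdd-∷ p ρ ρ≤p)))
             (regroup ⟦ odd p ⟧ (+ oddParts ρ) (conjOdd ρ) (+ p) (θ ρ) (+ size ρ))

-- β-sets

IsBeta : List ℕ → ℤ → Set
IsBeta μ m = ∃[ k ] + part μ k - + suc k ≡ m

part-beyond : ∀ μ {k} → length μ ℕ.≤ k → part μ k ≡ 0
part-beyond []      _             = refl
part-beyond (p ∷ μ) (ℕ.s≤s len≤k) = part-beyond μ len≤k

isBetaAt : List ℕ → ℤ → ℕ → Bool
isBetaAt μ m k = ⌊ (+ part μ k - + suc k) ℤ.≟ m ⌋

inS-sound : ∀ μ m → inS μ m ≡ true → IsBeta μ m
inS-sound μ m inS≡true with applyUpTo⁻ id (any⁻ (isBetaAt μ m) (upTo (suc (length μ ℕ.+ ∣ m ∣))) (Equivalence.from T-≡ inS≡true))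
... | k , _ , found = k , toWitness found

inS-complete : ∀ μ m → IsBeta μ m → inS μ m ≡ true
inS-complete μ m (k , eq) = Equivalence.to T-≡ (any⁺ (isBetaAt μ m) (applyUpTo⁺ id (fromWitness eq) k<bound))
  where
  k<bound : k ℕ.< suc (length μ ℕ.+ ∣ m ∣)
  k<bound with k ℕ.<? length μ
  ... | yes k<len = ℕ.s≤s (ℕP.≤-trans (ℕP.<⇒≤ k<len) (ℕP.m≤m+n (length μ) ∣ m ∣))
  ... | no  k≮len rewrite sym eq | part-beyond μ (ℕP.≮⇒≥ k≮len) =
        ℕ.s≤s (ℕP.≤-trans (ℕP.n≤1+n k) (ℕP.m≤n+m (suc k) (length μ)))

negative : ℤ → Bool
negative (+ _)    = false
negative -[1+ _ ] = true

-- inβ μ decides m ∈ S(μ), using S(p ∷ ρ) = {p − 1} ∪ (S(ρ) − 1) and S([]) = {m < 0}.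
inβ : List ℕ → ℤ → Bool
inβ []      m = negative m
inβ (p ∷ ρ) m = does (m ℤ.≟ + p - + 1) ∨ inβ ρ (m + + 1)

private
  shift-index : ∀ x k m → x - + suc k ≡ m + + 1 → x - + suc (suc k) ≡ m
  shift-index x k m eq = trans (x-[2+k]≡x-[1+k]-1 x (+ k)) (trans (cong (_- + 1) eq) (m+1-1≡m m))
    where
    x-[2+k]≡x-[1+k]-1 : ∀ x k → x - (+ 1 + (+ 1 + k)) ≡ x - (+ 1 + k) - + 1
    x-[2+k]≡x-[1+k]-1 = solve-∀
    m+1-1≡m : ∀ m → m + + 1 - + 1 ≡ m
    m+1-1≡m = solve-∀

  unshift-index : ∀ x k m → x - + suc (suc k) ≡ m → x - + suc k ≡ m + + 1
  unshift-index x k m refl = x-[1+k]≡x-[2+k]+1 x (+ k)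
    where
    x-[1+k]≡x-[2+k]+1 : ∀ x k → x - (+ 1 + k) ≡ x - (+ 1 + (+ 1 + k)) + + 1
    x-[1+k]≡x-[2+k]+1 = solve-∀

inβ-sound : ∀ μ m → inβ μ m ≡ true → IsBeta μ m
inβ-sound []      -[1+ n ] _ = n , refl
inβ-sound (p ∷ ρ) m inβ≡true with m ℤ.≟ + p - + 1
... | yes m≡p-1 = 0 , sym m≡p-1
... | no  _ with inβ-sound ρ (m + + 1) inβ≡true
...   | k , eq = suc k , shift-index (+ part ρ k) k m eq

inβ-complete : ∀ μ m → IsBeta μ m → inβ μ m ≡ true
inβ-complete []      _ (k , refl)     = refl
inβ-complete (p ∷ ρ) m (zero , eq)    rewrite dec-true (m ℤ.≟ + p - + 1) (sym eq) = refl
inβ-complete (p ∷ ρ) m (suc k , eq)   rewrite inβ-complete ρ (m + + 1) (k , unshift-index (+ part ρ k) k m eq) = ∨-zeroʳ _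

inS≡inβ : ∀ μ m → inS μ m ≡ inβ μ m
inS≡inβ μ m = ⇔→≡ {z = true} (mk⇔ (inβ-complete μ m ∘ inS-sound μ m) (inS-complete μ m ∘ inβ-sound μ m))

inβ-largest : ∀ p′ ρ → inβ (suc p′ ∷ ρ) (+ p′) ≡ true
inβ-largest p′ ρ rewrite dec-true (+ p′ ℤ.≟ + p′) refl = refl

inβ-at-−length : ∀ μ → All (0 ℕ.<_) μ → inβ μ (- + length μ) ≡ false
inβ-at-−length []             []      = refl
inβ-at-−length (suc p′ ∷ ρ) (_ ∷ pos) = trans (cong (inβ ρ) (-[1+L]+1≡-L (+ length ρ))) (inβ-at-−length ρ pos)
  where
  -[1+L]+1≡-L : ∀ L → - (+ 1 + L) + + 1 ≡ - L
  -[1+L]+1≡-L = solve-∀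

inβ-above-parts : ∀ {p} ρ → All (ℕ._≤ p) ρ → inβ ρ (+ p) ≡ false
inβ-above-parts {p} ρ ρ≤p with inβ ρ (+ p) in eq
... | false = refl
... | true with inβ-sound ρ (+ p) eq
...   | k , part-k≡ = contradiction (part≤ ρ ρ≤p k) (ℕP.<⇒≱ (subst (p ℕ.<_) (sym part≡) (ℕP.m<m+n p (ℕ.s≤s ℕ.z≤n))))
  where
  part≤ : ∀ ρ → All (ℕ._≤ p) ρ → ∀ k → part ρ k ℕ.≤ p
  part≤ []      _         _       = ℕ.z≤n
  part≤ (q ∷ ρ) (q≤p ∷ _) zero    = q≤p
  part≤ (q ∷ ρ) (_ ∷ ρ≤p) (suc k) = part≤ ρ ρ≤p k
  move : ∀ x y z → x - y ≡ z → x ≡ z + y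
  move x y z refl = x≡x-y+y x y
    where
    x≡x-y+y : ∀ x y → x ≡ x - y + y
    x≡x-y+y = solve-∀
  part≡ : part ρ k ≡ p ℕ.+ suc k
  part≡ = ℤP.+-injective (move (+ part ρ k) (+ suc k) (+ p) part-k≡)

-- λ₁ − 1 ∈ S(μ), so a strict upper bound for S(μ) bounds the largest part.
maxPart≤ : ∀ μ {X} → AllPairs ℕ._≥_ μ → All (0 ℕ.<_) μ → (∀ m → inβ μ m ≡ true → m ℤ.< + X) → maxPart μ ℕ.≤ X
maxPart≤ []           _           _                    _   = ℕ.z≤n
maxPart≤ (suc p′ ∷ ρ) (ρ≤p ∷ _) (ℕ.s≤s ℕ.z≤n ∷ _) S<X = ℕP.⊔-lub p≤X (ℕP.≤-trans (maxPart-lub ρ ρ≤p) p≤X)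
  where
  p≤X = ℤP.drop‿+<+ (S<X (+ p′) (inβ-largest p′ ρ))

-- Moments of β-sets

δ : ℤ → ℤ → ℤ
δ m a = ⟦ does (m ℤ.≟ a) ⟧

-- χ μ is the indicator function of S(μ) minus that of S([]); it vanishes outside [−ℓ(μ), λ₁).
χ : List ℕ → ℤ → ℤ
χ μ m = ⟦ inβ μ m ⟧ - ⟦ negative m ⟧

negative-shift : ∀ m → ⟦ negative m ⟧ ≡ ⟦ negative (m + + 1) ⟧ + δ m -[1+ 0 ]
negative-shift (+ n)            = refl
negative-shift -[1+ 0 ]         = refl
negative-shift -[1+ suc n ]     = refl

χ-∷ : ∀ p′ ρ → All (ℕ._≤ suc p′) ρ → ∀ m → χ (suc p′ ∷ ρ) m ≡ δ m (+ p′) + χ ρ (m + + 1) - δ m -[1+ 0 ]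
χ-∷ p′ ρ ρ≤p m with m ℤ.≟ + p′
... | yes refl rewrite ℕP.+-comm p′ 1 | inβ-above-parts ρ ρ≤p | dec-false (+ p′ ℤ.≟ -[1+ 0 ]) (λ ()) = refl
... | no  _ = trans (cong (_-_ ⟦ inβ ρ (m + + 1) ⟧) (negative-shift m)) (regroup ⟦ inβ ρ (m + + 1) ⟧ ⟦ negative (m + + 1) ⟧ (δ m -[1+ 0 ]))
  where
  regroup : ∀ a b c → a - (b + c) ≡ + 0 + (a - b) - c
  regroup = solve-∀

private
  +-cancelˡ : ∀ lo {x y} → lo + x ≡ lo + y → x ≡ y
  +-cancelˡ lo {x} {y} eq = trans (x≡lo+x-lo lo x) (trans (cong (_- lo) eq) (sym (x≡lo+x-lo lo y)))
    where
    x≡lo+x-lo : ∀ lo x → x ≡ lo + x - lo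
    x≡lo+x-lo = solve-∀

∑-δ : ∀ n lo {a} (h : ℤ → ℤ) → lo ℤ.≤ a → a ℤ.< lo + + n →
      ∑ n (λ j → δ (lo + + j) a * h (lo + + j)) ≡ h a
∑-δ n lo {a} h lo≤a a<lo+n =
  trans (∑-select n (λ j → does (lo + + j ℤ.≟ a)) (λ j → h (lo + + j)) k<n
                  (dec-true (lo + + k ℤ.≟ a) lo+k≡a)
                  (λ j j≢k → dec-false (lo + + j ℤ.≟ a) (λ lo+j≡a → j≢k (ℤP.+-injective (+-cancelˡ lo (trans lo+j≡a (sym lo+k≡a)))))))
        (cong h lo+k≡a)
  where
  k = ∣ a - lo ∣
  +k≡a-lo : + k ≡ a - lo
  +k≡a-lo = ℤP.0≤i⇒+∣i∣≡i (ℤP.i≤j⇒0≤j-i lo≤a)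
  lo+k≡a : lo + + k ≡ a
  lo+k≡a = trans (cong (_+_ lo) +k≡a-lo) (lo+[a-lo]≡a lo a)
    where
    lo+[a-lo]≡a : ∀ lo a → lo + (a - lo) ≡ a
    lo+[a-lo]≡a = solve-∀
  k<n : k ℕ.< n
  k<n = ℤP.drop‿+<+ (subst₂ ℤ._<_ (sym +k≡a-lo) (lo+n-lo≡n lo (+ n)) (ℤP.+-monoˡ-< (- lo) a<lo+n))
    where
    lo+n-lo≡n : ∀ lo n → lo + n - lo ≡ n
    lo+n-lo≡n = solve-∀

moment : List ℕ → (ℤ → ℤ) → ℤ → ℕ → ℤ
moment μ h lo n = ∑ n (λ j → χ μ (lo + + j) * h (lo + + j))

moment-cong : ∀ μ {f g : ℤ → ℤ} lo n → (∀ m → f m ≡ g m) → moment μ f lo n ≡ moment μ g lo n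
moment-cong μ lo n f≗g = ∑-cong n (λ j _ → cong (χ μ (lo + + j) *_) (f≗g (lo + + j)))

moment-distrib-minus : ∀ μ (f g : ℤ → ℤ) lo n → moment μ (λ m → f m - g m) lo n ≡ moment μ f lo n - moment μ g lo n
moment-distrib-minus μ f g lo n = trans (∑-cong n (λ j _ → distrib (χ μ (lo + + j)) (f (lo + + j)) (g (lo + + j))))
                                    (∑-distrib-minus n _ _)
  where
  distrib : ∀ c a b → c * (a - b) ≡ c * a - c * b
  distrib = solve-∀

moment-scale : ∀ μ c (f : ℤ → ℤ) lo n → moment μ (λ m → c * f m) lo n ≡ c * moment μ f lo n
moment-scale μ c f lo n = trans (∑-cong n (λ j _ → swap (χ μ (lo + + j)) c (f (lo + + j)))) (sym (*-distribˡ-∑ c n _))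
  where
  swap : ∀ x c y → x * (c * y) ≡ c * (x * y)
  swap = solve-∀

moment-[] : ∀ h lo n → moment [] h lo n ≡ + 0
moment-[] h lo n = ∑-zero n (λ j _ → cancel ⟦ negative (lo + + j) ⟧ (h (lo + + j)))
  where
  cancel : ∀ x y → (x - x) * y ≡ + 0
  cancel = solve-∀

Window : List ℕ → ℤ → ℕ → Set
Window μ lo n = lo ℤ.≤ - + length μ × + maxPart μ ℤ.≤ lo + + n

Window-∷ : ∀ {p′ ρ lo n} → All (ℕ._≤ suc p′) ρ → Window (suc p′ ∷ ρ) lo n → Window ρ (lo + + 1) n
Window-∷ {p′} {ρ} {lo} {n} ρ≤p (lo≤ , max≤) =
  subst (lo + + 1 ℤ.≤_) (-[1+L]+1≡-L (+ length ρ)) (ℤP.+-monoˡ-≤ (+ 1) lo≤) ,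
  (begin
    + maxPart ρ      ≤⟨ ℤ.+≤+ (maxPart-lub ρ ρ≤p) ⟩
    + suc p′         ≤⟨ ℤP.≤-trans (ℤ.+≤+ (ℕP.m≤m⊔n (suc p′) (maxPart ρ))) max≤ ⟩
    lo + + n         ≤⟨ ℤP.i≤i+j (lo + + n) (+ 1) ⟩
    lo + + n + + 1   ≡⟨ lo+n+1≡lo+1+n lo (+ n) ⟩
    lo + + 1 + + n   ∎)
  where
  open ℤP.≤-Reasoning
  -[1+L]+1≡-L : ∀ L → - (+ 1 + L) + + 1 ≡ - L
  -[1+L]+1≡-L = solve-∀
  lo+n+1≡lo+1+n : ∀ lo n → lo + n + + 1 ≡ lo + + 1 + n
  lo+n+1≡lo+1+n = solve-∀

moment-∷ : ∀ p′ ρ (h : ℤ → ℤ) lo n → All (ℕ._≤ suc p′) ρ → Window (suc p′ ∷ ρ) lo n →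
           moment (suc p′ ∷ ρ) h lo n ≡ h (+ p′) + moment ρ (λ m → h (m - + 1)) (lo + + 1) n - h -[1+ 0 ]
moment-∷ p′ ρ h lo n ρ≤p (lo≤ , max≤) = begin
  moment (suc p′ ∷ ρ) h lo n
    ≡⟨ ∑-cong n (λ j _ → trans (cong (_* h (at j)) (χ-∷ p′ ρ ρ≤p (at j))) (distrib (δ (at j) (+ p′)) (χ ρ (at j + + 1)) (δ (at j) -[1+ 0 ]) (h (at j)))) ⟩
  ∑ n (λ j → top j + shifted j - bottom j)
    ≡⟨ trans (∑-distrib-minus n (λ j → top j + shifted j) bottom) (cong (_- ∑ n bottom) (∑-distrib-+ n top shifted)) ⟩
  ∑ n top + ∑ n shifted - ∑ n bottom
    ≡⟨ cong₂ (λ x y → x + ∑ n shifted - y) (∑-δ n lo h lo≤p′ p′<hi) (∑-δ n lo h lo≤-1 -1<hi) ⟩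
  h (+ p′) + ∑ n shifted - h -[1+ 0 ]
    ≡⟨ cong (λ x → h (+ p′) + x - h -[1+ 0 ]) (∑-cong n (λ j _ → cong₂ (λ x y → χ ρ x * h y) (lo+j+1≡lo+1+j lo (+ j)) (lo+j≡lo+1+j-1 lo (+ j)))) ⟩
  h (+ p′) + moment ρ (λ m → h (m - + 1)) (lo + + 1) n - h -[1+ 0 ] ∎
  where
  open ≡-Reasoning
  at : ℕ → ℤ
  at j = lo + + j
  top shifted bottom : ℕ → ℤ
  top j     = δ (at j) (+ p′) * h (at j)
  shifted j = χ ρ (at j + + 1) * h (at j)
  bottom j  = δ (at j) -[1+ 0 ] * h (at j)
  distrib : ∀ a x b y → (a + x - b) * y ≡ a * y + x * y - b * y
  distrib = solve-∀
  lo+j+1≡lo+1+j : ∀ lo j → lo + j + + 1 ≡ lo + + 1 + j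
  lo+j+1≡lo+1+j = solve-∀
  lo+j≡lo+1+j-1 : ∀ lo j → lo + j ≡ lo + + 1 + j - + 1
  lo+j≡lo+1+j-1 = solve-∀
  lo≤-1 : lo ℤ.≤ -[1+ 0 ]
  lo≤-1 = ℤP.≤-trans lo≤ (ℤ.-≤- ℕ.z≤n)
  lo≤p′ : lo ℤ.≤ + p′
  lo≤p′ = ℤP.≤-trans lo≤-1 ℤ.-≤+
  p′<hi : + p′ ℤ.< lo + + n
  p′<hi = ℤP.<-≤-trans (ℤ.+<+ ℕP.≤-refl) (ℤP.≤-trans (ℤ.+≤+ (ℕP.m≤m⊔n (suc p′) (maxPart ρ))) max≤)
  -1<hi : -[1+ 0 ] ℤ.< lo + + n
  -1<hi = ℤP.<-trans ℤ.-<+ p′<hi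

moment-one : ∀ μ lo n → AllPairs ℕ._≥_ μ → All (0 ℕ.<_) μ → Window μ lo n → moment μ (λ _ → + 1) lo n ≡ + 0
moment-one []           lo n _                _                     _ = moment-[] (λ _ → + 1) lo n
moment-one (suc p′ ∷ ρ) lo n (ρ≤p ∷ sorted) (ℕ.s≤s ℕ.z≤n ∷ pos) w =
  trans (moment-∷ p′ ρ (λ _ → + 1) lo n ρ≤p w)
        (cong (λ x → + 1 + x - + 1) (moment-one ρ (lo + + 1) n sorted pos (Window-∷ ρ≤p w)))

moment-id : ∀ μ lo n → AllPairs ℕ._≥_ μ → All (0 ℕ.<_) μ → Window μ lo n → moment μ id lo n ≡ + size μ
moment-id []           lo n _                _                     _ = moment-[] id lo n
moment-id (suc p′ ∷ ρ) lo n (ρ≤p ∷ sorted) (ℕ.s≤s ℕ.z≤n ∷ pos) w = begin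
  moment (suc p′ ∷ ρ) id lo n
    ≡⟨ moment-∷ p′ ρ id lo n ρ≤p w ⟩
  + p′ + moment ρ (λ m → m - + 1) (lo + + 1) n - -[1+ 0 ]
    ≡⟨ cong (λ x → + p′ + x - -[1+ 0 ]) (moment-distrib-minus ρ id (λ _ → + 1) (lo + + 1) n) ⟩
  + p′ + (moment ρ id (lo + + 1) n - moment ρ (λ _ → + 1) (lo + + 1) n) - -[1+ 0 ]
    ≡⟨ cong₂ (λ x y → + p′ + (x - y) - -[1+ 0 ]) (moment-id ρ (lo + + 1) n sorted pos w′) (moment-one ρ (lo + + 1) n sorted pos w′) ⟩
  + p′ + (+ size ρ - + 0) - -[1+ 0 ]
    ≡⟨ p+[s-0]+1≡1+p+s (+ p′) (+ size ρ) ⟩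
  + 1 + + p′ + + size ρ ∎
  where
  open ≡-Reasoning
  w′ = Window-∷ ρ≤p w
  p+[s-0]+1≡1+p+s : ∀ p s → p + (s - + 0) - - + 1 ≡ + 1 + p + s
  p+[s-0]+1≡1+p+s = solve-∀

moment-θ : ∀ μ lo n → AllPairs ℕ._≥_ μ → All (0 ℕ.<_) μ → Window μ lo n → moment μ (λ m → m * m + m) lo n ≡ θ μ
moment-θ []           lo n _                _                     _ = moment-[] (λ m → m * m + m) lo n
moment-θ (suc p′ ∷ ρ) lo n (ρ≤p ∷ sorted) (ℕ.s≤s ℕ.z≤n ∷ pos) w = begin
  moment (suc p′ ∷ ρ) g lo n
    ≡⟨ moment-∷ p′ ρ g lo n ρ≤p w ⟩
  g (+ p′) + moment ρ (λ m → g (m - + 1)) (lo + + 1) n - g -[1+ 0 ]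
    ≡⟨ cong (λ x → g (+ p′) + x - g -[1+ 0 ]) (moment-cong ρ (lo + + 1) n (λ m → shift m)) ⟩
  g (+ p′) + moment ρ (λ m → g m - + 2 * m) (lo + + 1) n - g -[1+ 0 ]
    ≡⟨ cong (λ x → g (+ p′) + x - g -[1+ 0 ]) (trans (moment-distrib-minus ρ g (λ m → + 2 * m) (lo + + 1) n)
                                                     (cong (_-_ (moment ρ g (lo + + 1) n)) (moment-scale ρ (+ 2) id (lo + + 1) n))) ⟩
  g (+ p′) + (moment ρ g (lo + + 1) n - + 2 * moment ρ id (lo + + 1) n) - g -[1+ 0 ]
    ≡⟨ cong₂ (λ x y → g (+ p′) + (x - + 2 * y) - g -[1+ 0 ]) (moment-θ ρ (lo + + 1) n sorted pos w′) (moment-id ρ (lo + + 1) n sorted pos w′) ⟩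
  g (+ p′) + (θ ρ - + 2 * + size ρ) - g -[1+ 0 ]
    ≡⟨ recombine (+ p′) (θ ρ) (+ size ρ) ⟩
  θ (suc p′ ∷ ρ) ∎
  where
  open ≡-Reasoning
  w′ = Window-∷ ρ≤p w
  g : ℤ → ℤ
  g m = m * m + m
  shift : ∀ m → (m - + 1) * (m - + 1) + (m - + 1) ≡ m * m + m - + 2 * m
  shift = solve-∀
  recombine : ∀ p t s → p * p + p + (t - + 2 * s) - (- + 1 * - + 1 + - + 1) ≡ (+ 1 + p) * (+ 1 + p - + 1) + t - + 2 * s
  recombine = solve-∀

-- Words and their partitions

consNonzero : ℕ → List ℕ → List ℕ
consNonzero zero    q = q
consNonzero (suc k) q = suc k ∷ q

wordPartition : List Bool → List ℕ
wordPartition []          = []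
wordPartition (true  ∷ w) = wordPartition w
wordPartition (false ∷ w) = consNonzero (countTrue w) (wordPartition w)

wordPartition-≤ : ∀ w → All (ℕ._≤ countTrue w) (wordPartition w)
wordPartition-≤ []          = []
wordPartition-≤ (true  ∷ w) = All.map (λ q≤ → ℕP.≤-trans q≤ (ℕP.n≤1+n _)) (wordPartition-≤ w)
wordPartition-≤ (false ∷ w) with countTrue w | wordPartition-≤ w
... | zero  | q≤ = q≤
... | suc k | q≤ = ℕP.≤-refl ∷ q≤

wordPartition-sorted : ∀ w → AllPairs ℕ._≥_ (wordPartition w)
wordPartition-sorted []          = []
wordPartition-sorted (true  ∷ w) = wordPartition-sorted w
wordPartition-sorted (false ∷ w) with countTrue w | wordPartition-≤ w | wordPartition-sorted w
... | zero  | _  | sorted = sorted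
... | suc k | q≤ | sorted = q≤ ∷ sorted

wordPartition-noE : ∀ w → countTrue w ≡ 0 → wordPartition w ≡ []
wordPartition-noE []          _     = refl
wordPartition-noE (false ∷ w) noE rewrite noE = wordPartition-noE w noE

size-consNonzero : ∀ k q → + size (consNonzero k q) ≡ + k + + size q
size-consNonzero zero    q = sym (ℤP.+-identityˡ _)
size-consNonzero (suc k) q = refl

θ-consNonzero : ∀ k q → (k ≡ 0 → q ≡ []) → θ (consNonzero k q) ≡ + k * (+ k - + 1) + θ q - + 2 * + size q
θ-consNonzero zero    q q≡[] rewrite q≡[] refl = refl
θ-consNonzero (suc k) q _                      = refl

∑ᴱ : (ℤ → ℤ) → ℤ → List Bool → ℤ
∑ᴱ h x []      = + 0
∑ᴱ h x (b ∷ w) = ⟦ b ⟧ * h x + ∑ᴱ h (x + + 1) w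

∑ᴱ-replicate-shift : ∀ (h : ℤ → ℤ) x k → ∑ᴱ h x (replicate k true) ≡ ∑ᴱ h (x + + 1) (replicate k true) - h (x + + k) + h x
∑ᴱ-replicate-shift h x zero    = sym (trans (cong (λ y → + 0 - h y + h x) (ℤP.+-identityʳ x)) (0-a+a≡0 (h x)))
  where
  0-a+a≡0 : ∀ a → + 0 - a + a ≡ + 0
  0-a+a≡0 = solve-∀
∑ᴱ-replicate-shift h x (suc k) = begin
  + 1 * h x + ∑ᴱ h (x + + 1) (replicate k true)
    ≡⟨ cong (_+_ (+ 1 * h x)) (∑ᴱ-replicate-shift h (x + + 1) k) ⟩
  + 1 * h x + (∑ᴱ h (x + + 1 + + 1) (replicate k true) - h (x + + 1 + + k) + h (x + + 1))
    ≡⟨ cong (λ y → + 1 * h x + (∑ᴱ h (x + + 1 + + 1) (replicate k true) - h y + h (x + + 1))) (x+1+k≡x+[1+k] x (+ k)) ⟩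
  + 1 * h x + (∑ᴱ h (x + + 1 + + 1) (replicate k true) - h (x + + suc k) + h (x + + 1))
    ≡⟨ recombine (h x) (∑ᴱ h (x + + 1 + + 1) (replicate k true)) (h (x + + suc k)) (h (x + + 1)) ⟩
  + 1 * h (x + + 1) + ∑ᴱ h (x + + 1 + + 1) (replicate k true) - h (x + + suc k) + h x ∎
  where
  open ≡-Reasoning
  x+1+k≡x+[1+k] : ∀ x k → x + + 1 + k ≡ x + (+ 1 + k)
  x+1+k≡x+[1+k] = solve-∀
  recombine : ∀ a s c b → + 1 * a + (s - c + b) ≡ + 1 * b + s - c + a
  recombine = solve-∀

-- Compares w with the word having the same E's packed to the front; for h = id it counts the
-- pairs (N, later E), which is |wordPartition w|.
wordMoment : (ℤ → ℤ) → ℤ → List Bool → ℤ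
wordMoment h x w = ∑ᴱ h x w - ∑ᴱ h x (replicate (countTrue w) true)

wordMoment-E∷ : ∀ h x w → wordMoment h x (true ∷ w) ≡ wordMoment h (x + + 1) w
wordMoment-E∷ h x w = cancel-head (h x) (∑ᴱ h (x + + 1) w) (∑ᴱ h (x + + 1) (replicate (countTrue w) true))
  where
  cancel-head : ∀ a s t → + 1 * a + s - (+ 1 * a + t) ≡ s - t
  cancel-head = solve-∀

wordMoment-N∷ : ∀ h x w → wordMoment h x (false ∷ w) ≡ wordMoment h (x + + 1) w + (h (x + + countTrue w) - h x)
wordMoment-N∷ h x w =
  trans (cong (λ y → + 0 * h x + ∑ᴱ h (x + + 1) w - y) (∑ᴱ-replicate-shift h x (countTrue w)))
        (regroup (h x) (∑ᴱ h (x + + 1) w) (∑ᴱ h (x + + 1) (replicate (countTrue w) true)) (h (x + + countTrue w)))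
  where
  regroup : ∀ a s t c → + 0 * a + s - (t - c + a) ≡ s - t + (c - a)
  regroup = solve-∀

wordMoment-id : ∀ x w → wordMoment id x w ≡ + size (wordPartition w)
wordMoment-id x []          = refl
wordMoment-id x (true  ∷ w) = trans (wordMoment-E∷ id x w) (wordMoment-id (x + + 1) w)
wordMoment-id x (false ∷ w) = begin
  wordMoment id x (false ∷ w)                          ≡⟨ wordMoment-N∷ id x w ⟩
  wordMoment id (x + + 1) w + (x + + E - x)            ≡⟨ cong₂ _+_ (wordMoment-id (x + + 1) w) (x+e-x≡e x (+ E)) ⟩
  + size (wordPartition w) + + E                       ≡⟨ trans (ℤP.+-comm (+ size (wordPartition w)) (+ E)) (sym (size-consNonzero E (wordPartition w))) ⟩
  + size (consNonzero E (wordPartition w))             ∎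
  where
  open ≡-Reasoning
  E = countTrue w
  x+e-x≡e : ∀ x e → x + e - x ≡ e
  x+e-x≡e = solve-∀

wordMoment-square : ∀ x w → wordMoment (λ y → y * y) x w ≡
                    (+ 2 * (x + + countTrue w) - + 1) * + size (wordPartition w) - θ (wordPartition w)
wordMoment-square x []          = sym (cong (_- + 0) (ℤP.*-zeroʳ (+ 2 * (x + + 0) - + 1)))
wordMoment-square x (true  ∷ w) =
  trans (wordMoment-E∷ _ x w)
        (trans (wordMoment-square (x + + 1) w)
               (cong (λ y → (+ 2 * y - + 1) * + size (wordPartition w) - θ (wordPartition w)) (x+1+e≡x+[1+e] x (+ countTrue w))))
  where
  x+1+e≡x+[1+e] : ∀ x e → x + + 1 + e ≡ x + (+ 1 + e)
  x+1+e≡x+[1+e] = solve-∀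
wordMoment-square x (false ∷ w) = begin
  wordMoment sq x (false ∷ w)
    ≡⟨ wordMoment-N∷ sq x w ⟩
  wordMoment sq (x + + 1) w + (sq (x + + E) - sq x)
    ≡⟨ cong (_+ (sq (x + + E) - sq x)) (wordMoment-square (x + + 1) w) ⟩
  (+ 2 * (x + + 1 + + E) - + 1) * + size q - θ q + (sq (x + + E) - sq x)
    ≡⟨ recombine x (+ E) (+ size q) (θ q) ⟩
  (+ 2 * (x + + E) - + 1) * (+ E + + size q) - (+ E * (+ E - + 1) + θ q - + 2 * + size q)
    ≡⟨ cong₂ (λ s t → (+ 2 * (x + + E) - + 1) * s - t) (sym (size-consNonzero E q)) (sym (θ-consNonzero E q (wordPartition-noE w))) ⟩
  (+ 2 * (x + + E) - + 1) * + size (consNonzero E q) - θ (consNonzero E q) ∎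
  where
  open ≡-Reasoning
  E = countTrue w
  q = wordPartition w
  sq : ℤ → ℤ
  sq y = y * y
  recombine : ∀ x e s t → (+ 2 * (x + + 1 + e) - + 1) * s - t + ((x + e) * (x + e) - x * x) ≡
                       (+ 2 * (x + e) - + 1) * (e + s) - (e * (e - + 1) + t - + 2 * s)
  recombine = solve-∀

∑ᴱ-quadratic : ∀ a b c x w → ∑ᴱ (λ y → a * (y * y) + b * y + c) x w ≡
               a * ∑ᴱ (λ y → y * y) x w + b * ∑ᴱ id x w + c * ∑ᴱ (λ _ → + 1) x w
∑ᴱ-quadratic a b c x []      = 0≡a0+b0+c0 a b c
  where
  0≡a0+b0+c0 : ∀ a b c → + 0 ≡ a * + 0 + b * + 0 + c * + 0
  0≡a0+b0+c0 = solve-∀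
∑ᴱ-quadratic a b c x (e ∷ w) =
  trans (cong (_+_ (⟦ e ⟧ * (a * (x * x) + b * x + c))) (∑ᴱ-quadratic a b c (x + + 1) w))
        (regroup a b c x ⟦ e ⟧ (∑ᴱ (λ y → y * y) (x + + 1) w) (∑ᴱ id (x + + 1) w) (∑ᴱ (λ _ → + 1) (x + + 1) w))
  where
  regroup : ∀ a b c x e s₂ s₁ s₀ → e * (a * (x * x) + b * x + c) + (a * s₂ + b * s₁ + c * s₀) ≡
                                  a * (e * (x * x) + s₂) + b * (e * x + s₁) + c * (e * + 1 + s₀)
  regroup = solve-∀

∑ᴱ-one : ∀ x w → ∑ᴱ (λ _ → + 1) x w ≡ + countTrue w
∑ᴱ-one x []          = refl
∑ᴱ-one x (true  ∷ w) = cong (_+_ (+ 1)) (∑ᴱ-one (x + + 1) w)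
∑ᴱ-one x (false ∷ w) = trans (ℤP.+-identityˡ _) (∑ᴱ-one (x + + 1) w)

countTrue-replicate : ∀ k → countTrue (replicate k true) ≡ k
countTrue-replicate zero    = refl
countTrue-replicate (suc k) = cong suc (countTrue-replicate k)

wordMoment-quadratic : ∀ a b c x w → wordMoment (λ y → a * (y * y) + b * y + c) x w ≡
                       a * wordMoment (λ y → y * y) x w + b * wordMoment id x w
wordMoment-quadratic a b c x w = begin
  ∑ᴱ q x w - ∑ᴱ q x packed
    ≡⟨ cong₂ _-_ (∑ᴱ-quadratic a b c x w) (∑ᴱ-quadratic a b c x packed) ⟩
  a * ∑ᴱ sq x w + b * ∑ᴱ id x w + c * ∑ᴱ (λ _ → + 1) x w - (a * ∑ᴱ sq x packed + b * ∑ᴱ id x packed + c * ∑ᴱ (λ _ → + 1) x packed)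
    ≡⟨ cong₂ (λ u v → a * ∑ᴱ sq x w + b * ∑ᴱ id x w + c * u - (a * ∑ᴱ sq x packed + b * ∑ᴱ id x packed + c * v))
             (∑ᴱ-one x w) (trans (∑ᴱ-one x packed) (cong +_ (countTrue-replicate (countTrue w)))) ⟩
  a * ∑ᴱ sq x w + b * ∑ᴱ id x w + c * + countTrue w - (a * ∑ᴱ sq x packed + b * ∑ᴱ id x packed + c * + countTrue w)
    ≡⟨ regroup a b c (∑ᴱ sq x w) (∑ᴱ id x w) (∑ᴱ sq x packed) (∑ᴱ id x packed) (+ countTrue w) ⟩
  a * (∑ᴱ sq x w - ∑ᴱ sq x packed) + b * (∑ᴱ id x w - ∑ᴱ id x packed) ∎
  where
  open ≡-Reasoning
  packed = replicate (countTrue w) true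
  sq q : ℤ → ℤ
  sq y = y * y
  q y = a * (y * y) + b * y + c
  regroup : ∀ a b c s₂ s₁ p₂ p₁ e → a * s₂ + b * s₁ + c * e - (a * p₂ + b * p₁ + c * e) ≡ a * (s₂ - p₂) + b * (s₁ - p₁)
  regroup = solve-∀

countTrue-applyUpTo : ∀ n (b : ℕ → Bool) → + countTrue (applyUpTo b n) ≡ ∑ n (λ j → ⟦ b j ⟧)
countTrue-applyUpTo zero    b = refl
countTrue-applyUpTo (suc n) b with b 0
... | true  = cong (_+_ (+ 1)) (countTrue-applyUpTo n (b ∘ suc))
... | false = trans (countTrue-applyUpTo n (b ∘ suc)) (sym (ℤP.+-identityˡ _))

private
  shift-start : ∀ x j → x + + suc j ≡ x + + 1 + + j
  shift-start x j = x+[1+j]≡x+1+j x (+ j)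
    where
    x+[1+j]≡x+1+j : ∀ x j → x + (+ 1 + j) ≡ x + + 1 + j
    x+[1+j]≡x+1+j = solve-∀

∑ᴱ-applyUpTo : ∀ n (b : ℕ → Bool) (h : ℤ → ℤ) x → ∑ᴱ h x (applyUpTo b n) ≡ ∑ n (λ j → ⟦ b j ⟧ * h (x + + j))
∑ᴱ-applyUpTo zero    b h x = refl
∑ᴱ-applyUpTo (suc n) b h x =
  cong₂ _+_ (cong (λ y → ⟦ b 0 ⟧ * h y) (sym (ℤP.+-identityʳ x)))
            (trans (∑ᴱ-applyUpTo n (b ∘ suc) h (x + + 1))
                   (∑-cong n (λ j _ → cong (λ y → ⟦ b (suc j) ⟧ * h y) (sym (shift-start x j)))))

∑ᴱ-replicate : ∀ {k} n (h : ℤ → ℤ) x → k ℕ.≤ n → ∑ᴱ h x (replicate k true) ≡ ∑ n (λ j → ⟦ j ℕ.<ᵇ k ⟧ * h (x + + j))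
∑ᴱ-replicate {zero}  n       h x _           = sym (∑-zero n (λ j _ → ℤP.*-zeroˡ (h (x + + j))))
∑ᴱ-replicate {suc k} (suc n) h x (ℕ.s≤s k≤n) =
  cong₂ _+_ (cong (λ y → + 1 * h y) (sym (ℤP.+-identityʳ x)))
            (trans (∑ᴱ-replicate n h (x + + 1) k≤n)
                   (∑-cong n (λ j _ → cong (λ y → ⟦ j ℕ.<ᵇ k ⟧ * h y) (sym (shift-start x j)))))

countTrue≤length : ∀ w → countTrue w ℕ.≤ length w
countTrue≤length = LP.length-filter (λ b → b Data.Bool.≟ true)

wordMoment-applyUpTo : ∀ n (b : ℕ → Bool) (h : ℤ → ℤ) x →
  ∑ n (λ j → (⟦ b j ⟧ - ⟦ j ℕ.<ᵇ countTrue (applyUpTo b n) ⟧) * h (x + + j)) ≡ wordMoment h x (applyUpTo b n)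
wordMoment-applyUpTo n b h x = begin
  ∑ n (λ j → (⟦ b j ⟧ - ⟦ j ℕ.<ᵇ E ⟧) * h (x + + j))
    ≡⟨ ∑-cong n (λ j _ → distrib ⟦ b j ⟧ ⟦ j ℕ.<ᵇ E ⟧ (h (x + + j))) ⟩
  ∑ n (λ j → ⟦ b j ⟧ * h (x + + j) - ⟦ j ℕ.<ᵇ E ⟧ * h (x + + j))
    ≡⟨ ∑-distrib-minus n _ _ ⟩
  ∑ n (λ j → ⟦ b j ⟧ * h (x + + j)) - ∑ n (λ j → ⟦ j ℕ.<ᵇ E ⟧ * h (x + + j))
    ≡⟨ sym (cong₂ _-_ (∑ᴱ-applyUpTo n b h x) (∑ᴱ-replicate n h x E≤n)) ⟩
  wordMoment h x (applyUpTo b n) ∎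
  where
  open ≡-Reasoning
  E = countTrue (applyUpTo b n)
  E≤n : E ℕ.≤ n
  E≤n = ℕP.≤-trans (countTrue≤length (applyUpTo b n)) (ℕP.≤-reflexive (LP.length-applyUpTo b n))
  distrib : ∀ a b c → (a - b) * c ≡ a * c - b * c
  distrib = solve-∀

eAboveIn : (ℤ → Bool) → List ℤ → ℤ → ℕ
eAboveIn f xs r = countTrue (map f (filter (λ r′ → r ℤ.<? r′) xs))

-- quot t π i is quotientOf (W t π i) (window π) by definition.
quotientOf : (ℤ → Bool) → List ℤ → List ℕ
quotientOf f xs = filter (λ c → ¬? (c ℕ.≟ 0)) (map (eAboveIn f xs) (filter (λ r → f r Data.Bool.≟ false) xs))

quotientOf≡wordPartition : ∀ f xs → AllPairs ℤ._<_ xs → quotientOf f xs ≡ wordPartition (map f xs)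
quotientOf≡wordPartition f []       []             = refl
quotientOf≡wordPartition f (x ∷ xs) (x<xs ∷ sorted) = split (f x) refl
  where
  open ≡-Reasoning
  nonzero = λ c → ¬? (c ℕ.≟ 0)
  isN = λ r → f r Data.Bool.≟ false
  later : map (eAboveIn f (x ∷ xs)) (filter isN xs) ≡ map (eAboveIn f xs) (filter isN xs)
  later = LP.map-cong-local (AllP.filter⁺ isN (All.map (λ x<r → cong (countTrue ∘ map f)
            (LP.filter-reject (λ r′ → _ ℤ.<? r′) (ℤP.<-asym x<r))) x<xs))
  at-x : eAboveIn f (x ∷ xs) x ≡ countTrue (map f xs)
  at-x = cong (countTrue ∘ map f) (trans (LP.filter-reject (λ r′ → x ℤ.<? r′) (ℤP.<-irrefl refl))
                                         (LP.filter-all (λ r′ → x ℤ.<? r′) x<xs))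
  filter-nonzero-∷ : ∀ c cs → filter nonzero (c ∷ cs) ≡ consNonzero c (filter nonzero cs)
  filter-nonzero-∷ zero    cs = refl
  filter-nonzero-∷ (suc c) cs = refl
  split : ∀ b → f x ≡ b → quotientOf f (x ∷ xs) ≡ wordPartition (b ∷ map f xs)
  split true fx = begin
    filter nonzero (map (eAboveIn f (x ∷ xs)) (filter isN (x ∷ xs)))
      ≡⟨ cong (filter nonzero ∘ map (eAboveIn f (x ∷ xs))) (LP.filter-reject isN (λ fx≡false → true≢false (trans (sym fx) fx≡false))) ⟩
    filter nonzero (map (eAboveIn f (x ∷ xs)) (filter isN xs))
      ≡⟨ cong (filter nonzero) later ⟩
    quotientOf f xs
      ≡⟨ quotientOf≡wordPartition f xs sorted ⟩
    wordPartition (map f xs) ∎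
    where
    true≢false : true ≢ false
    true≢false ()
  split false fx = begin
    filter nonzero (map (eAboveIn f (x ∷ xs)) (filter isN (x ∷ xs)))
      ≡⟨ cong (filter nonzero ∘ map (eAboveIn f (x ∷ xs))) (LP.filter-accept isN fx) ⟩
    filter nonzero (eAboveIn f (x ∷ xs) x ∷ map (eAboveIn f (x ∷ xs)) (filter isN xs))
      ≡⟨ filter-nonzero-∷ (eAboveIn f (x ∷ xs) x) _ ⟩
    consNonzero (eAboveIn f (x ∷ xs) x) (filter nonzero (map (eAboveIn f (x ∷ xs)) (filter isN xs)))
      ≡⟨ cong₂ consNonzero at-x (cong (filter nonzero) later) ⟩
    consNonzero (countTrue (map f xs)) (quotientOf f xs)
      ≡⟨ cong (consNonzero (countTrue (map f xs))) (quotientOf≡wordPartition f xs sorted) ⟩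
    consNonzero (countTrue (map f xs)) (wordPartition (map f xs)) ∎

-- The t-core and the t-quotient

map-range : ∀ {A : Set} (f : ℤ → A) lo n → map f (range lo n) ≡ applyUpTo (λ j → f (lo + + j)) n
map-range f lo n = trans (cong (map f) (LP.map-upTo (λ j → lo + + j) n)) (LP.map-applyUpTo (λ j → lo + + j) f n)

module Decomposition (t : ℕ) {{_ : ℕ.NonZero t}} (π κ : List ℕ)
                     (π-partition : IsPartition π) (κ-core : IsTCoreOf t κ π) where

  B L : ℕ
  B = bound π
  L = suc (2 ℕ.* B)

  -- On the window r = −B + y (y < L) one has r − 1 = x₀ + y.
  x₀ : ℤ
  x₀ = - + suc B

  word : ℕ → List Bool
  word i = applyUpTo (λ y → W t π i (- + B + + y)) L

  E : ℕ → ℕ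
  E i = countTrue (word i)

  window-increasing : AllPairs ℤ._<_ (window π)
  window-increasing = subst (AllPairs ℤ._<_) (sym (LP.map-upTo (λ j → - + B + + j) L))
    (AllPairsP.applyUpTo⁺₁ _ L (λ i<j _ → ℤP.+-monoʳ-< (- + B) (ℤ.+<+ i<j)))

  quot≡wordPartition : ∀ i → quot t π i ≡ wordPartition (word i)
  quot≡wordPartition i = trans (quotientOf≡wordPartition (W t π i) (window π) window-increasing)
                               (cong wordPartition (map-range (W t π i) (- + B) L))

  nvec≡ : ∀ i → nvec t π i ≡ x₀ + + E i
  nvec≡ i = begin
    nvec t π i
      ≡⟨ cong₂ _-_ (count (W t π i) (+ 1) B) (count (not ∘ W t π i) (- + B) (suc B)) ⟩
    P - ∑ (suc B) (λ j → ⟦ not (W t π i (- + B + + j)) ⟧)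
      ≡⟨ cong (_-_ P) (trans (∑-cong (suc B) (λ j _ → ⟦not⟧ (W t π i (- + B + + j))))
                             (trans (∑-distrib-minus (suc B) (λ _ → + 1) (λ j → ⟦ W t π i (- + B + + j) ⟧)) (cong (_- N) (∑-const (suc B))))) ⟩
    P - (+ suc B - N)
      ≡⟨ regroup P N (+ suc B) ⟩
    x₀ + (N + P)
      ≡⟨ cong (_+_ x₀) (sym E≡N+P) ⟩
    x₀ + + E i ∎
    where
    open ≡-Reasoning
    count : ∀ (f : ℤ → Bool) lo n → + countTrue (map f (range lo n)) ≡ ∑ n (λ j → ⟦ f (lo + + j) ⟧)
    count f lo n = trans (cong (+_ ∘ countTrue) (map-range f lo n)) (countTrue-applyUpTo n (λ j → f (lo + + j)))
    ⟦not⟧ : ∀ b → ⟦ not b ⟧ ≡ + 1 - ⟦ b ⟧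
    ⟦not⟧ true  = refl
    ⟦not⟧ false = refl
    P N : ℤ
    P = ∑ B (λ j → ⟦ W t π i (+ 1 + + j) ⟧)
    N = ∑ (suc B) (λ j → ⟦ W t π i (- + B + + j) ⟧)
    regroup : ∀ P N S → P - (S - N) ≡ - S + (N + P)
    regroup = solve-∀
    E≡N+P : + E i ≡ N + P
    E≡N+P = begin
      + E i
        ≡⟨ countTrue-applyUpTo L (λ y → W t π i (- + B + + y)) ⟩
      ∑ L (λ y → ⟦ W t π i (- + B + + y) ⟧)
        ≡⟨ cong (λ n → ∑ n (λ y → ⟦ W t π i (- + B + + y) ⟧)) (cong (suc ∘ (B ℕ.+_)) (ℕP.+-identityʳ B)) ⟩
      ∑ (suc B ℕ.+ B) (λ y → ⟦ W t π i (- + B + + y) ⟧)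
        ≡⟨ ∑-split (suc B) B (λ y → ⟦ W t π i (- + B + + y) ⟧) ⟩
      N + ∑ B (λ j → ⟦ W t π i (- + B + + (suc B ℕ.+ j)) ⟧)
        ≡⟨ cong (_+_ N) (∑-cong B (λ j _ → cong (⟦_⟧ ∘ W t π i) (-b+[1+b+j]≡1+j (+ B) (+ j)))) ⟩
      N + P ∎
      where
      -b+[1+b+j]≡1+j : ∀ b j → - b + (+ 1 + b + j) ≡ + 1 + j
      -b+[1+b+j]≡1+j = solve-∀

  E≤L : ∀ i → E i ℕ.≤ L
  E≤L i = ℕP.≤-trans (countTrue≤length (word i)) (ℕP.≤-reflexive (LP.length-applyUpTo (λ y → W t π i (- + B + + y)) L))

  x₀≤nvec : ∀ i → x₀ ℤ.≤ nvec t π i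
  x₀≤nvec i = subst (x₀ ℤ.≤_) (sym (nvec≡ i)) (ℤP.i≤i+j x₀ (+ E i))

  nvec≤B : ∀ i → nvec t π i ℤ.≤ + B
  nvec≤B i = begin
    nvec t π i    ≡⟨ nvec≡ i ⟩
    x₀ + + E i    ≤⟨ ℤP.+-monoʳ-≤ x₀ (ℤ.+≤+ (E≤L i)) ⟩
    x₀ + + L      ≡⟨ cong (λ z → x₀ + (+ 1 + z)) (ℤP.pos-* 2 B) ⟩
    x₀ + (+ 1 + + 2 * + B) ≡⟨ -[1+b]+[1+2b]≡b (+ B) ⟩
    + B           ∎
    where
    open ℤP.≤-Reasoning
    -[1+b]+[1+2b]≡b : ∀ b → - (+ 1 + b) + (+ 1 + + 2 * b) ≡ b
    -[1+b]+[1+2b]≡b = solve-∀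

  core-word : ∀ i → i ℕ.< t → ∀ y → W t κ i (- + B + + y) ≡ (y ℕ.<ᵇ E i)
  core-word i i<t y = ⇔→≡ {z = true} (mk⇔ (to ∘ proj₁ (proj₂ κ-core i i<t r)) (proj₂ (proj₂ κ-core i i<t r) ∘ from))
    where
    r = - + B + + y
    shift : ∀ c {a b} → a ℤ.≤ b → a + c ℤ.≤ b + c
    shift c = ℤP.+-monoˡ-≤ c
    to : r ℤ.≤ nvec t π i → (y ℕ.<ᵇ E i) ≡ true
    to r≤n = Equivalence.to T-≡ (ℕP.<⇒<ᵇ (ℤP.drop‿+≤+ (subst₂ ℤ._≤_ (-b+y+[1+b]≡1+y (+ B) (+ y)) (trans (cong (_+ + suc B) (nvec≡ i)) (-[1+b]+e+[1+b]≡e (+ B) (+ E i))) (shift (+ suc B) r≤n))))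
      where
      -b+y+[1+b]≡1+y : ∀ b y → - b + y + (+ 1 + b) ≡ + 1 + y
      -b+y+[1+b]≡1+y = solve-∀
      -[1+b]+e+[1+b]≡e : ∀ b e → - (+ 1 + b) + e + (+ 1 + b) ≡ e
      -[1+b]+e+[1+b]≡e = solve-∀
    from : (y ℕ.<ᵇ E i) ≡ true → r ℤ.≤ nvec t π i
    from y<E = subst₂ ℤ._≤_ (1+y-[1+b]≡-b+y (+ B) (+ y)) (trans (e-[1+b]≡-[1+b]+e (+ B) (+ E i)) (sym (nvec≡ i)))
                      (shift (- + suc B) (ℤ.+≤+ (ℕP.<ᵇ⇒< y (E i) (Equivalence.from T-≡ y<E))))
      where
      1+y-[1+b]≡-b+y : ∀ b y → + 1 + y + - (+ 1 + b) ≡ - b + y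
      1+y-[1+b]≡-b+y = solve-∀
      e-[1+b]≡-[1+b]+e : ∀ b e → e + - (+ 1 + b) ≡ - (+ 1 + b) + e
      e-[1+b]≡-[1+b]+e = solve-∀

  LO : ℤ
  LO = + t * x₀

  N : ℕ
  N = t ℕ.* L

  LO+N≡ : LO + + N ≡ + B * + t
  LO+N≡ = trans (cong (_+_ LO) (trans (ℤP.pos-* t L) (cong (λ z → + t * (+ 1 + z)) (ℤP.pos-* 2 B)))) (t[-[1+b]]+t[1+2b]≡bt (+ t) (+ B))
    where
    t[-[1+b]]+t[1+2b]≡bt : ∀ t b → t * - (+ 1 + b) + t * (+ 1 + + 2 * b) ≡ b * t
    t[-[1+b]]+t[1+2b]≡bt = solve-∀

  inβ≡W : ∀ μ m → inβ μ m ≡ W t μ (m %ℕ t) (m /ℕ t + + 1)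
  inβ≡W μ m = trans (sym (inS≡inβ μ m)) (cong (inS μ) (trans (a≡a%ℕn+[a/ℕn]*n m t) (i+qt≡t[q+1-1]+i (+ (m %ℕ t)) (m /ℕ t) (+ t))))
    where
    i+qt≡t[q+1-1]+i : ∀ i q t → i + q * t ≡ t * (q + + 1 - + 1) + i
    i+qt≡t[q+1-1]+i = solve-∀

  π-window : Window π LO N
  π-window = left , right
    where
    B≤ : size π ℕ.+ length π ℕ.≤ B
    B≤ = ℕP.n≤1+n _
    left : LO ℤ.≤ - + length π
    left = begin
      + t * x₀            ≡⟨ t[-s]≡-[st] (+ t) (+ suc B) ⟩
      - (+ suc B * + t)   ≡⟨ cong -_ (sym (ℤP.pos-* (suc B) t)) ⟩
      - + (suc B ℕ.* t)   ≤⟨ ℤP.neg-mono-≤ (ℤ.+≤+ (ℕP.≤-trans (ℕP.≤-trans (ℕP.m≤n+m (length π) (size π)) (ℕP.≤-trans B≤ (ℕP.n≤1+n B))) (ℕP.m≤m*n (suc B) t))) ⟩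
      - + length π        ∎
      where
      open ℤP.≤-Reasoning
      t[-s]≡-[st] : ∀ t s → t * - s ≡ - (s * t)
      t[-s]≡-[st] = solve-∀
    right : + maxPart π ℤ.≤ LO + + N
    right = subst (+ maxPart π ℤ.≤_) (trans (ℤP.pos-* B t) (sym LO+N≡))
      (ℤ.+≤+ (ℕP.≤-trans (maxPart≤size π) (ℕP.≤-trans (ℕP.≤-trans (ℕP.m≤m+n (size π) (length π)) B≤) (ℕP.m≤m*n B t))))

  κ-sorted : AllPairs ℕ._≥_ κ
  κ-sorted = IsPartition⇒sorted (proj₁ κ-core)

  κ-positive : All (0 ℕ.<_) κ
  κ-positive = proj₂ (proj₁ κ-core)

  κ-window : Window κ LO N
  κ-window = left , subst (+ maxPart κ ℤ.≤_) (trans (ℤP.pos-* B t) (sym LO+N≡)) (ℤ.+≤+ (maxPart≤ κ κ-sorted κ-positive below))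
    where
    open ℤP.≤-Reasoning
    true≢false : true ≢ false
    true≢false ()
    left : LO ℤ.≤ - + length κ
    left = begin
      + t * x₀           ≡⟨ ℤP.*-comm (+ t) x₀ ⟩
      x₀ * + t           ≤⟨ ℤP.*-monoʳ-≤-nonNeg (+ t) x₀≤q ⟩
      q * + t            ≤⟨ ℤP.i≤j+i (q * + t) (+ i) ⟩
      + i + q * + t      ≡⟨ sym (a≡a%ℕn+[a/ℕn]*n m t) ⟩
      m                  ∎
      where
      m = - + length κ
      i = m %ℕ t
      q = m /ℕ t
      W≡false : W t κ i (q + + 1) ≡ false
      W≡false = trans (sym (inβ≡W κ m)) (inβ-at-−length κ κ-positive)
      n<q+1 : nvec t π i ℤ.< q + + 1
      n<q+1 = ℤP.≰⇒> (λ le → true≢false (trans (sym (proj₂ (proj₂ κ-core i (n%ℕd<d m t) (q + + 1)) le)) W≡false))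
      x₀≤q : x₀ ℤ.≤ q
      x₀≤q = subst (x₀ ℤ.≤_) (-1+[q+1]≡q q) (ℤP.i<j⇒i≤pred[j] (ℤP.≤-<-trans (x₀≤nvec i) n<q+1))
        where
        -1+[q+1]≡q : ∀ q → - + 1 + (q + + 1) ≡ q
        -1+[q+1]≡q = solve-∀
    below : ∀ m → inβ κ m ≡ true → m ℤ.< + (B ℕ.* t)
    below m m∈S = begin-strict
      m                  ≡⟨ a≡a%ℕn+[a/ℕn]*n m t ⟩
      + i + q * + t      <⟨ ℤP.+-monoˡ-< (q * + t) (ℤ.+<+ i<t) ⟩
      + t + q * + t      ≡⟨ t+qt≡[q+1]t (+ t) q ⟩
      (q + + 1) * + t    ≤⟨ ℤP.*-monoʳ-≤-nonNeg (+ t) (ℤP.≤-trans (proj₁ (proj₂ κ-core i i<t (q + + 1)) W≡true) (nvec≤B i)) ⟩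
      + B * + t          ≡⟨ sym (ℤP.pos-* B t) ⟩
      + (B ℕ.* t)        ∎
      where
      i = m %ℕ t
      q = m /ℕ t
      i<t = n%ℕd<d m t
      W≡true : W t κ i (q + + 1) ≡ true
      W≡true = trans (sym (inβ≡W κ m)) m∈S
      t+qt≡[q+1]t : ∀ t q → t + q * t ≡ (q + + 1) * t
      t+qt≡[q+1]t = solve-∀

  π-sorted : AllPairs ℕ._≥_ π
  π-sorted = IsPartition⇒sorted π-partition

  quot-sorted : ∀ i → AllPairs ℕ._≥_ (quot t π i)
  quot-sorted i = subst (AllPairs ℕ._≥_) (sym (quot≡wordPartition i)) (wordPartition-sorted (word i))

  residueTerm : ℕ → ℤ
  residueTerm i = + t * + t * ((+ 2 * nvec t π i - + 1) * + size (quot t π i) - θ (quot t π i))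
                + + t * (+ 2 * + i + + 1) * + size (quot t π i)

  -- g (t z + i) = Q i z
  g : ℤ → ℤ
  g m = m * m + m

  Q : ℕ → ℤ → ℤ
  Q i z = + t * + t * (z * z) + + t * (+ 2 * + i + + 1) * z + (+ i * + i + + i)

  βDifference : ℕ → ℤ
  βDifference k = (⟦ inβ π (LO + + k) ⟧ - ⟦ inβ κ (LO + + k) ⟧) * g (LO + + k)

  βDifference-at : ∀ i → i ℕ.< t → ∀ y →
                   βDifference (t ℕ.* y ℕ.+ i) ≡ (⟦ W t π i (- + B + + y) ⟧ - ⟦ y ℕ.<ᵇ E i ⟧) * Q i (x₀ + + y)
  βDifference-at i i<t y = begin
    (⟦ inβ π (LO + + (t ℕ.* y ℕ.+ i)) ⟧ - ⟦ inβ κ (LO + + (t ℕ.* y ℕ.+ i)) ⟧) * g (LO + + (t ℕ.* y ℕ.+ i))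
      ≡⟨ cong (λ m → (⟦ inβ π m ⟧ - ⟦ inβ κ m ⟧) * g m) position ⟩
    (⟦ inβ π m ⟧ - ⟦ inβ κ m ⟧) * g m
      ≡⟨ cong₂ (λ a b → (⟦ a ⟧ - ⟦ b ⟧) * g m) (sym (inS≡inβ π m)) (trans (sym (inS≡inβ κ m)) (core-word i i<t y)) ⟩
    (⟦ W t π i (- + B + + y) ⟧ - ⟦ y ℕ.<ᵇ E i ⟧) * g m
      ≡⟨ cong (_*_ (⟦ W t π i (- + B + + y) ⟧ - ⟦ y ℕ.<ᵇ E i ⟧)) (expand (+ t) (+ B) (+ y) (+ i)) ⟩
    (⟦ W t π i (- + B + + y) ⟧ - ⟦ y ℕ.<ᵇ E i ⟧) * Q i (x₀ + + y) ∎
    where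
    open ≡-Reasoning
    m = + t * (- + B + + y - + 1) + + i
    position : LO + + (t ℕ.* y ℕ.+ i) ≡ m
    position = trans (cong (λ z → LO + (z + + i)) (ℤP.pos-* t y)) (regroup (+ t) (+ B) (+ y) (+ i))
      where
      regroup : ∀ t b y i → t * - (+ 1 + b) + (t * y + i) ≡ t * (- b + y - + 1) + i
      regroup = solve-∀
    expand : ∀ t b y i → (t * (- b + y - + 1) + i) * (t * (- b + y - + 1) + i) + (t * (- b + y - + 1) + i) ≡
             t * t * ((- (+ 1 + b) + y) * (- (+ 1 + b) + y)) + t * (+ 2 * i + + 1) * (- (+ 1 + b) + y) + (i * i + i)
    expand = solve-∀

  residue-sum : ∀ i → i ℕ.< t → ∑ L (λ y → βDifference (t ℕ.* y ℕ.+ i)) ≡ residueTerm i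
  residue-sum i i<t = begin
    ∑ L (λ y → βDifference (t ℕ.* y ℕ.+ i))
      ≡⟨ ∑-cong L (λ y _ → βDifference-at i i<t y) ⟩
    ∑ L (λ y → (⟦ W t π i (- + B + + y) ⟧ - ⟦ y ℕ.<ᵇ E i ⟧) * Q i (x₀ + + y))
      ≡⟨ wordMoment-applyUpTo L (λ y → W t π i (- + B + + y)) (Q i) x₀ ⟩
    wordMoment (Q i) x₀ (word i)
      ≡⟨ wordMoment-quadratic a b (+ i * + i + + i) x₀ (word i) ⟩
    a * wordMoment (λ z → z * z) x₀ (word i) + b * wordMoment id x₀ (word i)
      ≡⟨ cong₂ (λ u v → a * u + b * v) (wordMoment-square x₀ (word i)) (wordMoment-id x₀ (word i)) ⟩
    a * ((+ 2 * (x₀ + + E i) - + 1) * + size (wordPartition (word i)) - θ (wordPartition (word i)))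
      + b * + size (wordPartition (word i))
      ≡⟨ cong₂ (λ n q → a * ((+ 2 * n - + 1) * + size q - θ q) + b * + size q) (sym (nvec≡ i)) (sym (quot≡wordPartition i)) ⟩
    residueTerm i ∎
    where
    open ≡-Reasoning
    a = + t * + t
    b = + t * (+ 2 * + i + + 1)

  θ-difference : θ π - θ κ ≡ ∑ t residueTerm
  θ-difference = begin
    θ π - θ κ
      ≡⟨ cong₂ _-_ (sym (moment-θ π LO N π-sorted (proj₂ π-partition) π-window))
                   (sym (moment-θ κ LO N κ-sorted κ-positive κ-window)) ⟩
    moment π g LO N - moment κ g LO N
      ≡⟨ sym (∑-distrib-minus N _ _) ⟩
    ∑ N (λ k → χ π (LO + + k) * g (LO + + k) - χ κ (LO + + k) * g (LO + + k))
      ≡⟨ ∑-cong N (λ k _ → cancel ⟦ inβ π (LO + + k) ⟧ ⟦ inβ κ (LO + + k) ⟧ ⟦ negative (LO + + k) ⟧ (g (LO + + k))) ⟩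
    ∑ N βDifference
      ≡⟨ ∑-residues t L βDifference ⟩
    ∑ t (λ i → ∑ L (λ y → βDifference (t ℕ.* y ℕ.+ i)))
      ≡⟨ ∑-cong t residue-sum ⟩
    ∑ t residueTerm ∎
    where
    open ≡-Reasoning
    cancel : ∀ a b c x → (a - c) * x - (b - c) * x ≡ (a - b) * x
    cancel = solve-∀

  srank≡residues : ∀ (r : ℕ → ℤ) → (∀ i → i ℕ.< t → + 4 ∣ˢ residueTerm i - r i) → srank π ≡₄ (srank κ + ∑ t r)
  srank≡residues r residues =
    ∣⇒∣ᵤ (subst (+ 4 ∣ˢ_) (sym eq) (∣m∣n⇒∣m+n (∣m∣n⇒∣m-n (srank≡θ-mod4 π π-sorted) (srank≡θ-mod4 κ κ-sorted))
                                              (∑-∣ t (λ i → residueTerm i - r i) residues)))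
    where
    open ≡-Reasoning
    regroup : ∀ x x′ y y′ R → x - (y + R) ≡ x - x′ - (y - y′) + (x′ - y′ - R)
    regroup = solve-∀
    eq : srank π - (srank κ + ∑ t r) ≡ srank π - θ π - (srank κ - θ κ) + ∑ t (λ i → residueTerm i - r i)
    eq = begin
      srank π - (srank κ + ∑ t r)                            ≡⟨ regroup (srank π) (θ π) (srank κ) (θ κ) (∑ t r) ⟩
      srank π - θ π - (srank κ - θ κ) + (θ π - θ κ - ∑ t r)  ≡⟨ cong (λ d → srank π - θ π - (srank κ - θ κ) + (d - ∑ t r)) θ-difference ⟩
      srank π - θ π - (srank κ - θ κ) + (∑ t residueTerm - ∑ t r)
        ≡⟨ cong (_+_ (srank π - θ π - (srank κ - θ κ))) (sym (∑-distrib-minus t residueTerm r)) ⟩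
      srank π - θ π - (srank κ - θ κ) + ∑ t (λ i → residueTerm i - r i) ∎

-- Reduction modulo 4

t≡t%4+[t/4]*4 : ∀ t → + t ≡ + (t % 4) + + (t ℕ./ 4) * + 4
t≡t%4+[t/4]*4 t = trans (cong +_ (m≡m%n+[m/n]*n t 4)) (cong (_+_ (+ (t % 4))) (ℤP.pos-* (t ℕ./ 4) 4))

t≡2a⇒residue-mod4 : ∀ {t a} i D s → t % 4 ≡ 2 ℕ.* a →
                    + 4 ∣ˢ + t * + t * D + + t * (+ 2 * + i + + 1) * s - + (2 ℕ.* a) * s
t≡2a⇒residue-mod4 {t} {a} i D s t%4≡2a =
  subst (λ A → + 4 ∣ˢ + t * + t * D + + t * (+ 2 * + i + + 1) * s - A * s) (sym (ℤP.pos-* 2 a))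
        (reduce (+ a) (+ (t ℕ./ 4)) (+ i) (trans (t≡t%4+[t/4]*4 t) (cong (_+ + (t ℕ./ 4) * + 4) (trans (cong +_ t%4≡2a) (ℤP.pos-* 2 a)))))
  where
  reduce : ∀ {T} a c i → T ≡ + 2 * a + c * + 4 → + 4 ∣ˢ T * T * D + T * (+ 2 * i + + 1) * s - + 2 * a * s
  reduce a c i refl = divides ((a + + 2 * c) * (a + + 2 * c) * D + (a * i + c * (+ 2 * i + + 1)) * s) (expand a c i D s)
    where
    expand : ∀ a c i D s → let T = + 2 * a + c * + 4 in
             T * T * D + T * (+ 2 * i + + 1) * s - + 2 * a * s ≡
             ((a + + 2 * c) * (a + + 2 * c) * D + (a * i + c * (+ 2 * i + + 1)) * s) * + 4
    expand = solve-∀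

t≡1+2a⇒residue-mod4 : ∀ {t a} i n s θq σ → t % 4 ≡ 1 ℕ.+ 2 ℕ.* a → + 2 ∣ˢ θq → + 4 ∣ˢ σ - θq →
  + 4 ∣ˢ + t * + t * ((+ 2 * n - + 1) * s - θq) + + t * (+ 2 * + i + + 1) * s - (+ 2 * ((n + + i + + a) * s) + σ)
t≡1+2a⇒residue-mod4 {t} {a} i n s θq σ t%4≡1+2a =
  reduce (+ a) (+ (t ℕ./ 4)) (+ i) (trans (t≡t%4+[t/4]*4 t)
    (cong (_+ + (t ℕ./ 4) * + 4) (trans (cong +_ t%4≡1+2a) (cong (_+_ (+ 1)) (ℤP.pos-* 2 a)))))
  where
  reduce : ∀ {T} a c i → T ≡ + 1 + + 2 * a + c * + 4 → + 2 ∣ˢ θq → + 4 ∣ˢ σ - θq →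
           + 4 ∣ˢ T * T * ((+ 2 * n - + 1) * s - θq) + T * (+ 2 * i + + 1) * s - (+ 2 * ((n + i + a) * s) + σ)
  reduce a c i refl (divides h refl) σ≡θq = subst (+ 4 ∣ˢ_) (sym (expand a c i n s h σ)) (∣m∣n⇒∣m-n (divides quotient refl) σ≡θq)
    where
    u = a + + 2 * c
    quotient = u * (u + + 1) * (+ 2 * n - + 1) * s + (a * i + c * (+ 2 * i + + 1)) * s - h * (+ 1 + + 2 * u * (u + + 1))
    expand : ∀ a c i n s h σ → let T = + 1 + + 2 * a + c * + 4 ; u = a + + 2 * c in
             T * T * ((+ 2 * n - + 1) * s - h * + 2) + T * (+ 2 * i + + 1) * s - (+ 2 * ((n + i + a) * s) + σ) ≡
             (u * (u + + 1) * (+ 2 * n - + 1) * s + (a * i + c * (+ 2 * i + + 1)) * s - h * (+ 1 + + 2 * u * (u + + 1))) * + 4 - (σ - h * + 2)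
    expand = solve-∀

*-Σ<≡∑ : ∀ c n (f : ℕ → ℤ) → c * Σ< n f ≡ ∑ n (λ i → c * f i)
*-Σ<≡∑ c n f = trans (cong (_*_ c) (Σ<≡∑ n f)) (*-distribˡ-∑ c n f)

Σ<-linear : ∀ x c n (f g : ℕ → ℤ) → x + c * Σ< n f + Σ< n g ≡ x + ∑ n (λ i → c * f i + g i)
Σ<-linear x c n f g = begin
  x + c * Σ< n f + Σ< n g                 ≡⟨ ℤP.+-assoc x _ _ ⟩
  x + (c * Σ< n f + Σ< n g)               ≡⟨ cong₂ (λ u v → x + (u + v)) (*-Σ<≡∑ c n f) (Σ<≡∑ n g) ⟩
  x + (∑ n (λ i → c * f i) + ∑ n g)       ≡⟨ cong (_+_ x) (sym (∑-distrib-+ n (λ i → c * f i) g)) ⟩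
  x + ∑ n (λ i → c * f i + g i)           ∎
  where open ≡-Reasoning

mainTheorem10 : (t a : ℕ) → 2 ≤ t → a ≤ 1 → (π κ : List ℕ) → IsPartition π → IsTCoreOf t κ π →
    (t % 4 ≡ 2 Data.Nat.* a →
      srank π ≡₄ (srank κ + + (2 Data.Nat.* a) * Σ< t (λ i → + size (quot t π i))))
    × (t % 4 ≡ 1 Data.Nat.+ 2 Data.Nat.* a →
      srank π ≡₄ (srank κ + + 2 * Σ< t (λ i → (nvec t π i + + i + + a) * + size (quot t π i)) + Σ< t (λ i → srank (quot t π i))))
mainTheorem10 t a t≥2 _ π κ π-partition κ-core =
  (λ t%4≡2a →
    subst (λ R → srank π ≡₄ (srank κ + R)) (sym (*-Σ<≡∑ (+ (2 ℕ.* a)) t s))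
      (srank≡residues _ (λ i _ → t≡2a⇒residue-mod4 {t} {a} i _ (s i) t%4≡2a))) ,
  (λ t%4≡1+2a →
    subst (srank π ≡₄_) (sym (Σ<-linear (srank κ) (+ 2) t (λ i → (nvec t π i + + i + + a) * s i) (srank ∘ quot t π)))
      (srank≡residues _ (λ i _ → t≡1+2a⇒residue-mod4 {t} {a} i (nvec t π i) (s i) _ _ t%4≡1+2a
                                   (θ-even (quot t π i)) (srank≡θ-mod4 (quot t π i) (quot-sorted i)))))
  where
  instance
    t≢0 : ℕ.NonZero t
    t≢0 = ℕ.>-nonZero (ℕP.<-≤-trans (ℕ.s≤s ℕ.z≤n) t≥2)
  open Decomposition t π κ π-partition κ-core
  s : ℕ → ℤ
  s i = + size (quot t π i)
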